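{- Let $n\geq1$, $m\geq2$ and let $\ell_a,\ell_b$ be integers with $m^n\geq\ell_a\geq\ell_b>0$. If $\ell_a+\ell_b\leq m^n$ then \[ |\Theta(Lex^{ -1}(n,m;\ell_a+\ell_b))|+\sigma_{n,m}(\ell_a,\ell_b)\leq|\Theta(Lex^{ -1}(n,m;\ell_a))|+|\Theta(Lex^{ -1}(n,m;\ell_b))|, \] and if $\ell_a+\ell_b\geq m^n$ then \[ |\Theta(Lex^{ -1}(n,m;\ell_a+\ell_b-m^n))|+\sigma_{n,m}(\ell_a,\ell_b)\leq|\Theta(Lex^{ -1}(n,m;\ell_a))|+|\Theta(Lex^{ -1}(n,m;\ell_b))|. \]
   Context: $S(n,m)$ ($n\geq1$, $m\geq2$) is the graph on $\{0,\dots,m-1\}^n$ in which distinct $u,v$ are adjacent iff there is $h\in\{1,\dots,n\}$ with $u_i=v_i$ for $i<h$, $u_h\neq v_h$, and $u_j=v_h$, $v_j=u_h$ for all $j>h$. For a vertex set $S$, $\Theta(S)$ is the set of edges with exactly one endpoint in $S$. $Lex(v)=1+\sum_{i=1}^n v_im^{n-i}$ and $Lex^{ -1}(n,m;\ell)=\{v:Lex(v)\leq\ell\}$. Corner vertices are $i^n=(i,\dots,i)$, $0\leq i\leq m-1$; $q_{n,m}(\ell)$ is the number of corner vertices $v$ with $Lex(v)\leq\ell$. For $0\leq\ell_b\leq\ell_a\leq m^n$, $\sigma_{n,m}(\ell_a,\ell_b)=q_{n,m}(\ell_b)+q_{n,m}(\ell_a+\ell_b)-q_{n,m}(\ell_a)$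 if $\ell_a+\ell_b<m^n$, and $\sigma_{n,m}(\ell_a,\ell_b)=q_{n,m}(\ell_b)-q_{n,m}(\ell_a+\ell_b-m^n)+m-q_{n,m}(\ell_a)$ if $\ell_a+\ell_b\geq m^n$. -}

module Defs where

open import Data.Bool using (Bool; true; false; _∧_; not)
open import Data.Nat using (ℕ; zero; suc; _+_; _*_; _∸_; _^_; _≤ᵇ_; _<ᵇ_)
open import Data.Fin using (Fin; toℕ)
import Data.Fin as Fin
open import Data.Vec using (Vec; []; _∷_; lookup; replicate)
open import Data.List using (List; []; _∷_; [_]; map; concatMap; length; filterᵇ; allFin)
open import Data.Bool.ListAction using (all; any)
open import Data.Product using (_×_; _,_)
open import Data.Integer using (ℤ; +_; _-_) renaming (_+_ to _+ℤ_)
open import Relation.Nullary.Decidable using (⌊_⌋)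

-- Vertices of S(n,m): words of length n over {0,…,m-1}.
Vertex : ℕ → ℕ → Set
Vertex n m = Vec (Fin m) n

allVertices : (n m : ℕ) → List (Vertex n m)
allVertices zero m = [ [] ]
allVertices (suc n) m = concatMap (λ i → map (i ∷_) (allVertices n m)) (allFin m)

_==_ : ∀ {m} → Fin m → Fin m → Bool
a == b = ⌊ a Fin.≟ b ⌋

-- Adjacency in S(n,m) (0-indexed positions): there is h with u_j = v_j for j < h,
-- u_h ≠ v_h, and u_j = v_h, v_j = u_h for all j > h.
adjacent : ∀ {n m} → Vertex n m → Vertex n m → Bool
adjacent {n} u v = any (λ h →
      all (λ j → not (toℕ j <ᵇ toℕ h) Data.Bool.∨ (lookup u j == lookup v j)) (allFin n)
    ∧ not (lookup u h == lookup v h)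
    ∧ all (λ j → not (toℕ h <ᵇ toℕ j) Data.Bool.∨
                   ((lookup u j == lookup v h) ∧ (lookup v j == lookup u h))) (allFin n))
  (allFin n)

lexVal : ∀ {n m} → Vertex n m → ℕ
lexVal {zero} [] = 0
lexVal {suc n} {m} (x ∷ xs) = toℕ x * m ^ n + lexVal xs

Lex : ∀ {n m} → Vertex n m → ℕ
Lex v = suc (lexVal v)

inLex⁻¹ : ∀ {n m} → ℕ → Vertex n m → Bool
inLex⁻¹ ℓ v = Lex v ≤ᵇ ℓ

-- |Θ(Lex^{-1}(n,m;ℓ))|: number of edges {u,v} with u ∈ Lex^{-1}, v ∉ Lex^{-1}
-- (each such edge counted once, via the ordered pair (inside, outside)).
thetaLex : (n m ℓ : ℕ) → ℕ
thetaLex n m ℓ = length (filterᵇ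
  (λ { (u , v) → inLex⁻¹ ℓ u ∧ not (inLex⁻¹ ℓ v) ∧ adjacent u v })
  (concatMap (λ u → map (u ,_) (allVertices n m)) (allVertices n m)))

q : (n m ℓ : ℕ) → ℕ
q n m ℓ = length (filterᵇ (λ i → inLex⁻¹ ℓ (replicate n i)) (allFin m))

σ : (n m ℓa ℓb : ℕ) → ℤ
σ n m ℓa ℓb with ℓa + ℓb <ᵇ m ^ n
... | true  = (+ q n m ℓb +ℤ + q n m (ℓa + ℓb)) - + q n m ℓa
... | false = ((+ q n m ℓb - + q n m (ℓa + ℓb ∸ m ^ n)) +ℤ + m) - + q n m ℓa

-- Write θₙ(ℓ) = |Θ(Lex⁻¹(n,m;ℓ))|, qₙ(ℓ) = q_{n,m}(ℓ) and ℓ = k·mⁿ + r with k < m, 1 ≤ r ≤ mⁿ.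
-- S(n+1,m) is m copies i·S(n,m) joined by the bridge edges {i jⁿ, j iⁿ} (i ≠ j), and
-- Lex⁻¹(n+1,m;ℓ) fills the copies i < k, meets copy k in Lex⁻¹(n,m;r) and misses the copies
-- i > k. A corner jⁿ lies in Lex⁻¹(n,m;r) iff j < qₙ(r), so counting cut bridges gives, with
-- x = qₙ(r),
--   θₙ₊₁(ℓ) = θₙ(r) + k(m−1−k) + (k ∸ x) + (x ∸ (k+1)),   qₙ₊₁(ℓ) = k + [k < x],
-- hence Φ = θ + q satisfies Φₙ₊₁(ℓ) = Φₙ(r) + k(m−1−k) + 2(k ∸ x). As q is monotone,
-- q(ℓa) ⊓ q(ℓb) = q(ℓb), and the two claims read
--   Φ(a + b) + 2(q a ⊓ q b) ≤ Φ a + Φ b               if a + b ≤ mⁿ,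
--   Φ(c) + m + 2(q a ⊓ q b) ≤ Φ a + Φ b + 2 q c       if a + b = mⁿ + c.
-- Both are proved together by induction on n: adding the leading digits of a and b, with or
-- without a carry from the lower digits, the step is the hypothesis for the lower digits plus an
-- inequality between the leading digits k, k′ and the corner counts of the lower digits.

module Submission where

open import Defs
open import Data.Bool using (Bool; true; false; _∧_; _∨_; not)
open import Data.Bool.Properties using (∧-assoc; ∧-zeroʳ; ∨-identityʳ)
open import Data.Nat
  using ( ℕ; zero; suc; _+_; _*_; _∸_; _^_; _≤ᵇ_; _<ᵇ_; _≡ᵇ_; _≤_; _<_; _≥_; _⊓_; _⊔_
        ; z≤n; s≤s; _≤?_; _<?_; NonZero; >-nonZero)
open import Data.Nat.Properties
open import Data.Nat.DivMod using (_/_; _%_; m≡m%n+[m/n]*n; m%n<n; m<n*o⇒m/o<n)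
open import Data.Nat.Tactic.RingSolver using (solve-∀)
open import Data.Fin using (Fin; toℕ; fromℕ<) renaming (zero to fzero; suc to fsuc)
import Data.Fin as Fin
import Data.Fin.Properties as Fin
open import Data.Vec using ([]; _∷_; lookup; replicate)
open import Data.List using (List; []; _∷_; map; concatMap; length; filterᵇ; allFin; _++_)
open import Data.List.Properties using (map-tabulate)
open import Data.Bool.ListAction using (all; any)
open import Data.Product using (∃; _×_; _,_; proj₁; proj₂)
open import Data.Sum using (inj₁; inj₂)
open import Data.Empty using (⊥-elim)
open import Function using (_∘_; _⟨_⟩_)
open import Relation.Binary using (tri<; tri≈; tri>)
open import Relation.Binary.PropositionalEquality
open import Relation.Nullary using (yes; no)

𝟙 : Bool → ℕ
𝟙 true = 1
𝟙 false = 0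

𝟙-∧ : ∀ a b → 𝟙 (a ∧ b) ≡ 𝟙 a * 𝟙 b
𝟙-∧ true b = sym (+-identityʳ (𝟙 b))
𝟙-∧ false b = refl

𝟙≤1 : ∀ b → 𝟙 b ≤ 1
𝟙≤1 true = ≤-refl
𝟙≤1 false = z≤n

𝟙-mono : ∀ {a b} → (a ≡ true → b ≡ true) → 𝟙 a ≤ 𝟙 b
𝟙-mono {false} _ = z≤n
𝟙-mono {true} a⇒b rewrite a⇒b refl = ≤-refl

∑ : {A : Set} → (A → ℕ) → List A → ℕ
∑ f [] = 0
∑ f (x ∷ xs) = f x + ∑ f xs

module _ {A : Set} where

  length-filterᵇ : ∀ (p : A → Bool) xs → length (filterᵇ p xs) ≡ ∑ (𝟙 ∘ p) xs
  length-filterᵇ p [] = refl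
  length-filterᵇ p (x ∷ xs) with p x
  ... | true = cong suc (length-filterᵇ p xs)
  ... | false = length-filterᵇ p xs

  ∑-cong : ∀ {f g : A → ℕ} → (∀ x → f x ≡ g x) → ∀ xs → ∑ f xs ≡ ∑ g xs
  ∑-cong f≗g [] = refl
  ∑-cong f≗g (x ∷ xs) = cong₂ _+_ (f≗g x) (∑-cong f≗g xs)

  ∑-++ : ∀ (f : A → ℕ) xs ys → ∑ f (xs ++ ys) ≡ ∑ f xs + ∑ f ys
  ∑-++ f [] ys = refl
  ∑-++ f (x ∷ xs) ys = trans (cong (f x +_) (∑-++ f xs ys)) (sym (+-assoc (f x) _ _))

  ∑-+ : ∀ (f g : A → ℕ) xs → ∑ (λ x → f x + g x) xs ≡ ∑ f xs + ∑ g xs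
  ∑-+ f g [] = refl
  ∑-+ f g (x ∷ xs) = trans (cong (f x + g x +_) (∑-+ f g xs)) (shuffle (f x) (g x) (∑ f xs) (∑ g xs))
    where
    shuffle : ∀ a b c d → a + b + (c + d) ≡ a + c + (b + d)
    shuffle = solve-∀

  ∑-*ˡ : ∀ c (f : A → ℕ) xs → ∑ (λ x → c * f x) xs ≡ c * ∑ f xs
  ∑-*ˡ c f [] = sym (*-zeroʳ c)
  ∑-*ˡ c f (x ∷ xs) = trans (cong (c * f x +_) (∑-*ˡ c f xs)) (sym (*-distribˡ-+ c (f x) (∑ f xs)))

  ∑-zero : ∀ (f : A → ℕ) → (∀ x → f x ≡ 0) → ∀ xs → ∑ f xs ≡ 0
  ∑-zero f f≗0 [] = refl
  ∑-zero f f≗0 (x ∷ xs) = cong₂ _+_ (f≗0 x) (∑-zero f f≗0 xs)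

∑-swap : ∀ {A B : Set} (f : A → B → ℕ) xs ys →
         ∑ (λ x → ∑ (f x) ys) xs ≡ ∑ (λ y → ∑ (λ x → f x y) xs) ys
∑-swap f [] ys = sym (∑-zero _ (λ _ → refl) ys)
∑-swap f (x ∷ xs) ys =
  trans (cong (∑ (f x) ys +_) (∑-swap f xs ys)) (sym (∑-+ (f x) (λ y → ∑ (λ x' → f x' y) xs) ys))

∑∑-+ : ∀ {A B : Set} (f g : A → B → ℕ) xs ys →
       ∑ (λ x → ∑ (λ y → f x y + g x y) ys) xs ≡ ∑ (λ x → ∑ (f x) ys) xs + ∑ (λ x → ∑ (g x) ys) xs
∑∑-+ f g xs ys = trans (∑-cong (λ x → ∑-+ (f x) (g x) ys) xs) (∑-+ _ _ xs)

∑-map : ∀ {A B : Set} (f : B → ℕ) (g : A → B) xs → ∑ f (map g xs) ≡ ∑ (f ∘ g) xs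
∑-map f g [] = refl
∑-map f g (x ∷ xs) = cong (f (g x) +_) (∑-map f g xs)

∑-concatMap : ∀ {A B : Set} (f : B → ℕ) (g : A → List B) xs →
              ∑ f (concatMap g xs) ≡ ∑ (λ x → ∑ f (g x)) xs
∑-concatMap f g [] = refl
∑-concatMap f g (x ∷ xs) =
  trans (∑-++ f (g x) (concatMap g xs)) (cong (∑ f (g x) +_) (∑-concatMap f g xs))

allFin-suc : ∀ n → allFin (suc n) ≡ fzero ∷ map fsuc (allFin n)
allFin-suc n = cong (fzero ∷_) (sym (map-tabulate (λ i → i) fsuc))

all-map : ∀ {A B : Set} (p : B → Bool) (g : A → B) xs → all p (map g xs) ≡ all (p ∘ g) xs
all-map p g [] = refl
all-map p g (x ∷ xs) = cong (p (g x) ∧_) (all-map p g xs)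

any-map : ∀ {A B : Set} (p : B → Bool) (g : A → B) xs → any p (map g xs) ≡ any (p ∘ g) xs
any-map p g [] = refl
any-map p g (x ∷ xs) = cong (p (g x) ∨_) (any-map p g xs)

all-allFin-suc : ∀ {n} (p : Fin (suc n) → Bool) → all p (allFin (suc n)) ≡ p fzero ∧ all (p ∘ fsuc) (allFin n)
all-allFin-suc {n} p = trans (cong (all p) (allFin-suc n)) (cong (p fzero ∧_) (all-map p fsuc (allFin n)))

any-allFin-suc : ∀ {n} (p : Fin (suc n) → Bool) → any p (allFin (suc n)) ≡ p fzero ∨ any (p ∘ fsuc) (allFin n)
any-allFin-suc {n} p = trans (cong (any p) (allFin-suc n)) (cong (p fzero ∨_) (any-map p fsuc (allFin n)))

∑-allFin-suc : ∀ {n} (f : Fin (suc n) → ℕ) → ∑ f (allFin (suc n)) ≡ f fzero + ∑ (f ∘ fsuc) (allFin n)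
∑-allFin-suc {n} f = trans (cong (∑ f) (allFin-suc n)) (cong (f fzero +_) (∑-map f fsuc (allFin n)))

module _ {A : Set} where

  all-cong : ∀ {p q : A → Bool} → (∀ x → p x ≡ q x) → ∀ xs → all p xs ≡ all q xs
  all-cong p≗q [] = refl
  all-cong p≗q (x ∷ xs) = cong₂ _∧_ (p≗q x) (all-cong p≗q xs)

  any-cong : ∀ {p q : A → Bool} → (∀ x → p x ≡ q x) → ∀ xs → any p xs ≡ any q xs
  any-cong p≗q [] = refl
  any-cong p≗q (x ∷ xs) = cong₂ _∨_ (p≗q x) (any-cong p≗q xs)

  all-true : ∀ (p : A → Bool) → (∀ x → p x ≡ true) → ∀ xs → all p xs ≡ true
  all-true p p≗true xs = trans (all-cong p≗true xs) (constTrue xs)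
    where
    constTrue : ∀ xs → all (λ _ → true) xs ≡ true
    constTrue [] = refl
    constTrue (_ ∷ xs) = constTrue xs

  all-∧ : ∀ (p q : A → Bool) xs → all (λ x → p x ∧ q x) xs ≡ all p xs ∧ all q xs
  all-∧ p q [] = refl
  all-∧ p q (x ∷ xs) = trans (cong ((p x ∧ q x) ∧_) (all-∧ p q xs)) (interchange (p x) (q x) (all p xs) (all q xs))
    where
    interchange : ∀ a b c d → (a ∧ b) ∧ (c ∧ d) ≡ (a ∧ c) ∧ (b ∧ d)
    interchange true true c d = refl
    interchange true false c d = sym (∧-zeroʳ c)
    interchange false b c d = refl

  any-∧ˡ : ∀ b (p : A → Bool) xs → any (λ x → b ∧ p x) xs ≡ b ∧ any p xs
  any-∧ˡ true p xs = refl
  any-∧ˡ false p [] = refl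
  any-∧ˡ false p (x ∷ xs) = any-∧ˡ false p xs

<⇒<ᵇ≡true : ∀ {a b} → a < b → (a <ᵇ b) ≡ true
<⇒<ᵇ≡true {zero} (s≤s _) = refl
<⇒<ᵇ≡true {suc a} (s≤s a<b) = <⇒<ᵇ≡true a<b

≥⇒<ᵇ≡false : ∀ {a b} → b ≤ a → (a <ᵇ b) ≡ false
≥⇒<ᵇ≡false {a} {zero} z≤n = refl
≥⇒<ᵇ≡false (s≤s b≤a) = ≥⇒<ᵇ≡false b≤a

≤⇒≤ᵇ≡true : ∀ {a b} → a ≤ b → (a ≤ᵇ b) ≡ true
≤⇒≤ᵇ≡true {zero} _ = refl
≤⇒≤ᵇ≡true {suc a} a<b = <⇒<ᵇ≡true a<b

>⇒≤ᵇ≡false : ∀ {a b} → b < a → (a ≤ᵇ b) ≡ false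
>⇒≤ᵇ≡false {suc a} (s≤s b≤a) = ≥⇒<ᵇ≡false b≤a

<ᵇ≡true⇒< : ∀ a b → (a <ᵇ b) ≡ true → a < b
<ᵇ≡true⇒< a b a<ᵇb with <-cmp a b
... | tri< a<b _ _ = a<b
... | tri≈ _ refl _ with () ← trans (sym a<ᵇb) (≥⇒<ᵇ≡false {a} ≤-refl)
... | tri> _ _ b<a with () ← trans (sym a<ᵇb) (≥⇒<ᵇ≡false (<⇒≤ b<a))

<ᵇ≡false⇒≥ : ∀ a b → (a <ᵇ b) ≡ false → b ≤ a
<ᵇ≡false⇒≥ a b a≮ᵇb with <-cmp a b
... | tri< a<b _ _ with () ← trans (sym (<⇒<ᵇ≡true a<b)) a≮ᵇb
... | tri≈ _ refl _ = ≤-refl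
... | tri> _ _ b<a = <⇒≤ b<a

≡ᵇ-refl : ∀ a → (a ≡ᵇ a) ≡ true
≡ᵇ-refl zero = refl
≡ᵇ-refl (suc a) = ≡ᵇ-refl a

≢⇒≡ᵇ≡false : ∀ {a b} → a ≢ b → (a ≡ᵇ b) ≡ false
≢⇒≡ᵇ≡false {zero} {zero} a≢b = ⊥-elim (a≢b refl)
≢⇒≡ᵇ≡false {zero} {suc b} _ = refl
≢⇒≡ᵇ≡false {suc a} {zero} _ = refl
≢⇒≡ᵇ≡false {suc a} {suc b} a≢b = ≢⇒≡ᵇ≡false (a≢b ∘ cong suc)

not-<ᵇ : ∀ a b → not (a <ᵇ b) ≡ (b ≤ᵇ a)
not-<ᵇ a b with <-cmp a b
... | tri< a<b _ _ rewrite <⇒<ᵇ≡true a<b | >⇒≤ᵇ≡false a<b = refl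
... | tri≈ _ refl _ rewrite ≥⇒<ᵇ≡false {a} ≤-refl | ≤⇒≤ᵇ≡true {a} ≤-refl = refl
... | tri> _ _ b<a rewrite ≥⇒<ᵇ≡false (<⇒≤ b<a) | ≤⇒≤ᵇ≡true (<⇒≤ b<a) = refl

∑< : ℕ → (ℕ → ℕ) → ℕ
∑< zero f = 0
∑< (suc m) f = ∑< m f + f m

∑<-shift : ∀ m (f : ℕ → ℕ) → ∑< (suc m) f ≡ f 0 + ∑< m (f ∘ suc)
∑<-shift zero f = sym (+-identityʳ (f 0))
∑<-shift (suc m) f = trans (cong (_+ f (suc m)) (∑<-shift m f)) (+-assoc (f 0) _ _)

∑-allFin≡∑< : ∀ m (f : ℕ → ℕ) → ∑ (f ∘ toℕ) (allFin m) ≡ ∑< m f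
∑-allFin≡∑< zero f = refl
∑-allFin≡∑< (suc m) f =
  trans (∑-allFin-suc {m} (f ∘ toℕ)) (trans (cong (f 0 +_) (∑-allFin≡∑< m (f ∘ suc))) (sym (∑<-shift m f)))

∑<-cong : ∀ m {f g : ℕ → ℕ} → (∀ i → i < m → f i ≡ g i) → ∑< m f ≡ ∑< m g
∑<-cong zero f≗g = refl
∑<-cong (suc m) f≗g = cong₂ _+_ (∑<-cong m (λ i i<m → f≗g i (m<n⇒m<1+n i<m))) (f≗g m ≤-refl)

∑<-mono : ∀ m {f g : ℕ → ℕ} → (∀ i → i < m → f i ≤ g i) → ∑< m f ≤ ∑< m g
∑<-mono zero f≤g = z≤n
∑<-mono (suc m) f≤g = +-mono-≤ (∑<-mono m (λ i i<m → f≤g i (m<n⇒m<1+n i<m))) (f≤g m ≤-refl)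

∑<-+ : ∀ m (f g : ℕ → ℕ) → ∑< m (λ i → f i + g i) ≡ ∑< m f + ∑< m g
∑<-+ zero f g = refl
∑<-+ (suc m) f g = trans (cong (_+ (f m + g m)) (∑<-+ m f g)) (shuffle (∑< m f) (∑< m g) (f m) (g m))
  where
  shuffle : ∀ a b c d → a + b + (c + d) ≡ a + c + (b + d)
  shuffle = solve-∀

∑<-*ˡ : ∀ m c (f : ℕ → ℕ) → ∑< m (λ i → c * f i) ≡ c * ∑< m f
∑<-*ˡ zero c f = sym (*-zeroʳ c)
∑<-*ˡ (suc m) c f = trans (cong (_+ c * f m) (∑<-*ˡ m c f)) (sym (*-distribˡ-+ c (∑< m f) (f m)))

∑<-*ʳ : ∀ m c (f : ℕ → ℕ) → ∑< m (λ i → f i * c) ≡ ∑< m f * c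
∑<-*ʳ m c f = trans (∑<-cong m (λ i _ → *-comm (f i) c)) (trans (∑<-*ˡ m c f) (*-comm c _))

∑<-zero : ∀ m (f : ℕ → ℕ) → (∀ i → i < m → f i ≡ 0) → ∑< m f ≡ 0
∑<-zero m f f≗0 = ∑<-cong m f≗0 ⟨ trans ⟩ zeros m
  where
  zeros : ∀ m → ∑< m (λ _ → 0) ≡ 0
  zeros zero = refl
  zeros (suc m) = trans (+-identityʳ _) (zeros m)

∑<-single : ∀ m k (f : ℕ → ℕ) → k < m → (∀ i → i < m → i ≢ k → f i ≡ 0) → ∑< m f ≡ f k
∑<-single (suc m) k f k<1+m f≗0 with <-cmp k m
... | tri< k<m _ _ = trans (cong₂ _+_ (∑<-single m k f k<m (λ i i<m → f≗0 i (m<n⇒m<1+n i<m))) (f≗0 m ≤-refl (<⇒≢ k<m ∘ sym)))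
                           (+-identityʳ (f k))
... | tri≈ _ refl _ = cong (_+ f k) (∑<-zero m f (λ i i<m → f≗0 i (m<n⇒m<1+n i<m) (<⇒≢ i<m)))
... | tri> _ _ m<k = ⊥-elim (<⇒≱ m<k (≤-pred k<1+m))

∑<-delta : ∀ m k (f : ℕ → ℕ) → k < m → ∑< m (λ i → 𝟙 (i ≡ᵇ k) * f i) ≡ f k
∑<-delta m k f k<m =
  trans (∑<-single m k (λ i → 𝟙 (i ≡ᵇ k) * f i) k<m (λ i _ i≢k → cong (λ b → 𝟙 b * f i) (≢⇒≡ᵇ≡false i≢k)))
        (trans (cong (λ b → 𝟙 b * f k) (≡ᵇ-refl k)) (+-identityʳ (f k)))

∑<-interval : ∀ m a b → ∑< m (λ i → 𝟙 (a ≤ᵇ i) * 𝟙 (i <ᵇ b)) ≡ b ⊓ m ∸ a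
∑<-interval zero a b = sym (trans (cong (_∸ a) (⊓-zeroʳ b)) (0∸n≡0 a))
∑<-interval (suc m) a b rewrite ∑<-interval m a b with <-cmp m b
... | tri< m<b _ _ rewrite <⇒<ᵇ≡true m<b | m≥n⇒m⊓n≡n (<⇒≤ m<b) | m≥n⇒m⊓n≡n m<b with a ≤? m
...   | yes a≤m rewrite ≤⇒≤ᵇ≡true a≤m = trans (+-comm (m ∸ a) 1) (sym (+-∸-assoc 1 a≤m))
...   | no a≰m rewrite >⇒≤ᵇ≡false (≰⇒> a≰m) | m≤n⇒m∸n≡0 (≰⇒> a≰m) | m≤n⇒m∸n≡0 (<⇒≤ (≰⇒> a≰m)) = refl
∑<-interval (suc m) a b | tri≈ _ refl _
  rewrite ≥⇒<ᵇ≡false {m} ≤-refl | *-zeroʳ (𝟙 (a ≤ᵇ m)) | +-identityʳ (m ⊓ m ∸ a) | ⊓-idem m | m≤n⇒m⊓n≡m (n≤1+n m) = refl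
∑<-interval (suc m) a b | tri> _ _ b<m
  rewrite ≥⇒<ᵇ≡false (<⇒≤ b<m) | *-zeroʳ (𝟙 (a ≤ᵇ m)) | +-identityʳ (b ⊓ m ∸ a)
        | m≤n⇒m⊓n≡m (<⇒≤ b<m) | m≤n⇒m⊓n≡m (<⇒≤ (m<n⇒m<1+n b<m)) = refl

∑<-<ᵇ : ∀ m b → ∑< m (λ i → 𝟙 (i <ᵇ b)) ≡ b ⊓ m
∑<-<ᵇ m b = trans (∑<-cong m (λ i _ → sym (+-identityʳ (𝟙 (i <ᵇ b))))) (∑<-interval m 0 b)

∑<->ᵇ : ∀ m k → ∑< m (λ j → 𝟙 (k <ᵇ j)) ≡ m ∸ suc k
∑<->ᵇ m k =
  trans (∑<-cong m (λ j j<m → trans (sym (*-identityʳ (𝟙 (k <ᵇ j)))) (cong (λ b → 𝟙 (k <ᵇ j) * 𝟙 b) (sym (<⇒<ᵇ≡true j<m)))))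
        (trans (∑<-interval m (suc k) m) (cong (_∸ suc k) (⊓-idem m)))

∑<-𝟙-all : ∀ m (p : ℕ → Bool) → (∀ j → j < m → p j ≡ true) → ∑< m (𝟙 ∘ p) ≡ m
∑<-𝟙-all zero p _ = refl
∑<-𝟙-all (suc m) p all-p rewrite all-p m ≤-refl | ∑<-𝟙-all m p (λ j j<m → all-p j (m<n⇒m<1+n j<m)) = +-comm m 1

∑<-𝟙≤ : ∀ m (p : ℕ → Bool) → ∑< m (𝟙 ∘ p) ≤ m
∑<-𝟙≤ m p = ≤-trans (∑<-mono m (λ i _ → 𝟙≤1 (p i))) (≤-reflexive (∑<-𝟙-all m (λ _ → true) (λ _ _ → refl)))

DownClosed : (ℕ → Bool) → Set
DownClosed p = ∀ i j → i ≤ j → p j ≡ true → p i ≡ true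

downClosed-threshold : ∀ m (p : ℕ → Bool) → DownClosed p → ∀ j → j < m → p j ≡ (j <ᵇ ∑< m (𝟙 ∘ p))
downClosed-threshold (suc m) p closed j j<1+m with p m in pm
... | true = trans (closed j m (≤-pred j<1+m) pm) (sym (trans (cong (j <ᵇ_) count≡1+m) (<⇒<ᵇ≡true j<1+m)))
  where
  count≡1+m : ∑< m (𝟙 ∘ p) + 1 ≡ suc m
  count≡1+m = trans (cong (_+ 1) (∑<-𝟙-all m p (λ i i<m → closed i m (<⇒≤ i<m) pm))) (+-comm m 1)
... | false rewrite +-identityʳ (∑< m (𝟙 ∘ p)) with <-cmp j m
...   | tri< j<m _ _ = downClosed-threshold m p closed j j<m
...   | tri≈ _ refl _ = trans pm (sym (≥⇒<ᵇ≡false (∑<-𝟙≤ j p)))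
...   | tri> _ _ m<j = ⊥-elim (<⇒≱ m<j (≤-pred j<1+m))

≤ᵇ-shift : ∀ a b ℓ → (suc (a + b) ≤ᵇ ℓ) ≡ (suc b ≤ᵇ ℓ ∸ a)
≤ᵇ-shift zero b ℓ = refl
≤ᵇ-shift (suc a) b zero = refl
≤ᵇ-shift (suc a) b (suc ℓ) = ≤ᵇ-shift a b ℓ

block-≤ᵇ : ∀ M k r i t → r ≤ M → t < M →
           (suc (i * M + t) ≤ᵇ k * M + r) ≡ ((i <ᵇ k) ∨ ((i ≡ᵇ k) ∧ (suc t ≤ᵇ r)))
block-≤ᵇ M k r i t r≤M t<M with <-cmp i k
... | tri< i<k _ _ rewrite <⇒<ᵇ≡true i<k = ≤⇒≤ᵇ≡true (begin
  suc (i * M + t)  ≡⟨ sym (+-suc (i * M) t) ⟩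
  i * M + suc t    ≤⟨ +-monoʳ-≤ (i * M) t<M ⟩
  i * M + M        ≡⟨ +-comm (i * M) M ⟩
  suc i * M        ≤⟨ *-monoˡ-≤ M i<k ⟩
  k * M            ≤⟨ m≤m+n (k * M) r ⟩
  k * M + r        ∎)
  where open ≤-Reasoning
... | tri≈ _ refl _ rewrite ≥⇒<ᵇ≡false {i} ≤-refl | ≡ᵇ-refl i =
  trans (≤ᵇ-shift (i * M) t (i * M + r)) (cong (suc t ≤ᵇ_) (m+n∸m≡n (i * M) r))
... | tri> _ _ k<i rewrite ≥⇒<ᵇ≡false (<⇒≤ k<i) | ≢⇒≡ᵇ≡false (<⇒≢ k<i ∘ sym) = >⇒≤ᵇ≡false (begin-strict
  k * M + r        ≤⟨ +-monoʳ-≤ (k * M) r≤M ⟩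
  k * M + M        ≡⟨ +-comm (k * M) M ⟩
  suc k * M        ≤⟨ *-monoˡ-≤ M k<i ⟩
  i * M            ≤⟨ m≤m+n (i * M) t ⟩
  i * M + t        <⟨ n<1+n _ ⟩
  suc (i * M + t)  ∎)
  where open ≤-Reasoning

-- Adjacency in S(n+1,m)

==-fsuc : ∀ {m} (i j : Fin m) → (fsuc i == fsuc j) ≡ (i == j)
==-fsuc i j with i Fin.≟ j
... | yes _ = refl
... | no _ = refl

==-refl : ∀ {m} (i : Fin m) → (i == i) ≡ true
==-refl fzero = refl
==-refl (fsuc i) = trans (==-fsuc i i) (==-refl i)

==-sym : ∀ {m} (i j : Fin m) → (i == j) ≡ (j == i)
==-sym fzero fzero = refl
==-sym fzero (fsuc j) = refl
==-sym (fsuc i) fzero = refl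
==-sym (fsuc i) (fsuc j) = trans (==-fsuc i j) (trans (==-sym i j) (sym (==-fsuc j i)))

==-toℕ : ∀ {m} (i j : Fin m) → (i == j) ≡ (toℕ i ≡ᵇ toℕ j)
==-toℕ fzero fzero = refl
==-toℕ fzero (fsuc j) = refl
==-toℕ (fsuc i) fzero = refl
==-toℕ (fsuc i) (fsuc j) = trans (==-fsuc i j) (==-toℕ i j)

∑-delta : ∀ {m} (i : Fin m) (F : Fin m → ℕ) → ∑ (λ j → 𝟙 (j == i) * F j) (allFin m) ≡ F i
∑-delta {suc m} fzero F = begin
  ∑ (λ j → 𝟙 (j == fzero) * F j) (allFin (suc m))  ≡⟨ ∑-allFin-suc (λ j → 𝟙 (j == fzero) * F j) ⟩
  F fzero + 0 + ∑ (λ _ → 0) (allFin m)              ≡⟨ cong₂ _+_ (+-identityʳ (F fzero)) (∑-zero _ (λ _ → refl) (allFin m)) ⟩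
  F fzero + 0                                        ≡⟨ +-identityʳ (F fzero) ⟩
  F fzero                                            ∎
  where open ≡-Reasoning
∑-delta {suc m} (fsuc i) F = begin
  ∑ (λ j → 𝟙 (j == fsuc i) * F j) (allFin (suc m))    ≡⟨ ∑-allFin-suc (λ j → 𝟙 (j == fsuc i) * F j) ⟩
  ∑ (λ j → 𝟙 (fsuc j == fsuc i) * F (fsuc j)) (allFin m) ≡⟨ ∑-cong (λ j → cong (λ b → 𝟙 b * F (fsuc j)) (==-fsuc j i)) (allFin m) ⟩
  ∑ (λ j → 𝟙 (j == i) * F (fsuc j)) (allFin m)          ≡⟨ ∑-delta i (F ∘ fsuc) ⟩
  F (fsuc i)                                             ∎
  where open ≡-Reasoning

∑-delta′ : ∀ {m} (i : Fin m) (F : Fin m → ℕ) → ∑ (λ j → 𝟙 (i == j) * F j) (allFin m) ≡ F i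
∑-delta′ {m} i F = trans (∑-cong (λ j → cong (λ b → 𝟙 b * F j) (==-sym i j)) (allFin m)) (∑-delta i F)

∑-allVertices-suc : ∀ {n m} (g : Vertex (suc n) m → ℕ) →
  ∑ g (allVertices (suc n) m) ≡ ∑ (λ i → ∑ (λ u → g (i ∷ u)) (allVertices n m)) (allFin m)
∑-allVertices-suc {n} {m} g =
  trans (∑-concatMap g (λ i → map (i ∷_) (allVertices n m)) (allFin m))
        (∑-cong (λ i → ∑-map g (i ∷_) (allVertices n m)) (allFin m))

isReplicate : ∀ {n m} → Vertex n m → Fin m → Bool
isReplicate {n} u j = all (λ t → lookup u t == j) (allFin n)

isReplicate-∷ : ∀ {n m} (i j : Fin m) (u : Vertex n m) → isReplicate (i ∷ u) j ≡ (i == j) ∧ isReplicate u j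
isReplicate-∷ i j u = all-allFin-suc (λ t → lookup (i ∷ u) t == j)

∑-isReplicate : ∀ {n m} (i : Fin m) (G : Vertex n m → ℕ) →
                ∑ (λ v → 𝟙 (isReplicate v i) * G v) (allVertices n m) ≡ G (replicate n i)
∑-isReplicate {zero} i G = trans (+-identityʳ _) (+-identityʳ _)
∑-isReplicate {suc n} {m} i G = begin
  ∑ (λ v → 𝟙 (isReplicate v i) * G v) (allVertices (suc n) m)
    ≡⟨ ∑-allVertices-suc (λ v → 𝟙 (isReplicate v i) * G v) ⟩
  ∑ (λ j → ∑ (λ v → 𝟙 (isReplicate (j ∷ v) i) * G (j ∷ v)) (allVertices n m)) (allFin m)
    ≡⟨ ∑-cong (λ j → ∑-cong (peel j) (allVertices n m)) (allFin m) ⟩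
  ∑ (λ j → ∑ (λ v → 𝟙 (j == i) * (𝟙 (isReplicate v i) * G (j ∷ v))) (allVertices n m)) (allFin m)
    ≡⟨ ∑-cong (λ j → trans (∑-*ˡ (𝟙 (j == i)) _ (allVertices n m))
                           (cong (𝟙 (j == i) *_) (∑-isReplicate i (G ∘ (j ∷_))))) (allFin m) ⟩
  ∑ (λ j → 𝟙 (j == i) * G (j ∷ replicate n i)) (allFin m)
    ≡⟨ ∑-delta i (λ j → G (j ∷ replicate n i)) ⟩
  G (replicate (suc n) i) ∎
  where
  open ≡-Reasoning
  peel : ∀ j v → 𝟙 (isReplicate (j ∷ v) i) * G (j ∷ v) ≡ 𝟙 (j == i) * (𝟙 (isReplicate v i) * G (j ∷ v))
  peel j v = trans (cong (λ b → 𝟙 b * G (j ∷ v)) (isReplicate-∷ j i v))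
                   (trans (cong (_* G (j ∷ v)) (𝟙-∧ (j == i) (isReplicate v i))) (*-assoc (𝟙 (j == i)) _ _))

agreeBefore swappedAfter : ∀ {k m} → Vertex k m → Vertex k m → Fin k → Fin k → Bool
agreeBefore u v h j = not (toℕ j <ᵇ toℕ h) ∨ (lookup u j == lookup v j)
swappedAfter u v h j = not (toℕ h <ᵇ toℕ j) ∨ ((lookup u j == lookup v h) ∧ (lookup v j == lookup u h))

splitsAt : ∀ {k m} → Vertex k m → Vertex k m → Fin k → Bool
splitsAt {k} u v h =
  all (agreeBefore u v h) (allFin k) ∧ not (lookup u h == lookup v h) ∧ all (swappedAfter u v h) (allFin k)

module _ {n m : ℕ} (i j : Fin m) (u v : Vertex n m) where

  splitsAt-fzero : splitsAt (i ∷ u) (j ∷ v) fzero ≡ not (i == j) ∧ (isReplicate u j ∧ isReplicate v i)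
  splitsAt-fzero =
    cong₂ (λ a c → a ∧ not (i == j) ∧ c)
          (all-true (agreeBefore (i ∷ u) (j ∷ v) fzero) (λ _ → refl) (allFin (suc n)))
          (trans (all-allFin-suc (swappedAfter (i ∷ u) (j ∷ v) fzero)) (all-∧ (λ t → lookup u t == j) (λ t → lookup v t == i) (allFin n)))

  splitsAt-fsuc : ∀ h → splitsAt (i ∷ u) (j ∷ v) (fsuc h) ≡ (i == j) ∧ splitsAt u v h
  splitsAt-fsuc h =
    trans (cong₂ (λ a c → a ∧ not (lookup u h == lookup v h) ∧ c) (all-allFin-suc (agreeBefore (i ∷ u) (j ∷ v) (fsuc h)))
                                                                     (all-allFin-suc (swappedAfter (i ∷ u) (j ∷ v) (fsuc h))))
          (∧-assoc (i == j) _ _)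

  adjacent-∷ : adjacent (i ∷ u) (j ∷ v) ≡ (not (i == j) ∧ (isReplicate u j ∧ isReplicate v i)) ∨ ((i == j) ∧ adjacent u v)
  adjacent-∷ =
    trans (any-allFin-suc (splitsAt (i ∷ u) (j ∷ v)))
          (cong₂ _∨_ splitsAt-fzero (trans (any-cong splitsAt-fsuc (allFin n)) (any-∧ˡ (i == j) (splitsAt u v) (allFin n))))

𝟙-either : ∀ e x y → 𝟙 ((not e ∧ x) ∨ (e ∧ y)) ≡ 𝟙 e * 𝟙 y + 𝟙 (not e) * 𝟙 x
𝟙-either true x y = sym (trans (+-identityʳ _) (+-identityʳ (𝟙 y)))
𝟙-either false x y = trans (cong 𝟙 (∨-identityʳ x)) (sym (+-identityʳ (𝟙 x)))

𝟙-adjacent-∷ : ∀ {n m} (i j : Fin m) (u v : Vertex n m) →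
  𝟙 (adjacent (i ∷ u) (j ∷ v)) ≡ 𝟙 (i == j) * 𝟙 (adjacent u v) + 𝟙 (not (i == j)) * (𝟙 (isReplicate u j) * 𝟙 (isReplicate v i))
𝟙-adjacent-∷ i j u v =
  trans (cong 𝟙 (adjacent-∷ i j u v))
        (trans (𝟙-either (i == j) _ (adjacent u v))
               (cong (λ k → 𝟙 (i == j) * 𝟙 (adjacent u v) + 𝟙 (not (i == j)) * k) (𝟙-∧ (isReplicate u j) _)))

-- The cut of Lex⁻¹(n+1,m;ℓ)

crosses : ∀ {n m} → ℕ → Vertex n m → Vertex n m → ℕ
crosses ℓ u v = 𝟙 (inLex⁻¹ ℓ u) * 𝟙 (not (inLex⁻¹ ℓ v)) * 𝟙 (adjacent u v)

boundary : (n m ℓ : ℕ) → ℕ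
boundary n m ℓ = ∑ (λ u → ∑ (crosses ℓ u) (allVertices n m)) (allVertices n m)

thetaLex≡boundary : ∀ n m ℓ → thetaLex n m ℓ ≡ boundary n m ℓ
thetaLex≡boundary n m ℓ =
  trans (length-filterᵇ _ (concatMap (λ u → map (u ,_) V) V))
  (trans (∑-concatMap _ (λ u → map (u ,_) V) V)
         (∑-cong (λ u → trans (∑-map _ (u ,_) V) (∑-cong (λ v → 𝟙-∧³ (inLex⁻¹ ℓ u) (inLex⁻¹ ℓ v) (adjacent u v)) V)) V))
  where
  V = allVertices n m
  𝟙-∧³ : ∀ a b c → 𝟙 (a ∧ not b ∧ c) ≡ 𝟙 a * 𝟙 (not b) * 𝟙 c
  𝟙-∧³ a b c = trans (𝟙-∧ a _) (trans (cong (𝟙 a *_) (𝟙-∧ (not b) c)) (sym (*-assoc (𝟙 a) _ _)))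

bridges : (n m ℓ : ℕ) → ℕ
bridges n m ℓ =
  ∑ (λ i → ∑ (λ j → 𝟙 (not (i == j)) * 𝟙 (inLex⁻¹ ℓ (i ∷ replicate n j)) * 𝟙 (not (inLex⁻¹ ℓ (j ∷ replicate n i))))
             (allFin m))
    (allFin m)

inLex⁻¹-∷ : ∀ {n m} ℓ (i : Fin m) (u : Vertex n m) → inLex⁻¹ ℓ (i ∷ u) ≡ inLex⁻¹ (ℓ ∸ toℕ i * m ^ n) u
inLex⁻¹-∷ {n} {m} ℓ i u = ≤ᵇ-shift (toℕ i * m ^ n) (lexVal u) ℓ

module _ (n m ℓ : ℕ) where

  private
    V = allVertices n m
    In : ∀ {k} → Vertex k m → ℕ
    In w = 𝟙 (inLex⁻¹ ℓ w)
    Out : ∀ {k} → Vertex k m → ℕ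
    Out w = 𝟙 (not (inLex⁻¹ ℓ w))
    within : Fin m → Vertex n m → Vertex n m → ℕ
    within i u v = In (i ∷ u) * Out (i ∷ v) * 𝟙 (adjacent u v)
    bridge : Fin m → Fin m → Vertex n m → ℕ
    bridge i j u = 𝟙 (not (i == j)) * 𝟙 (isReplicate u j) * In (i ∷ u) * Out (j ∷ replicate n i)

  crosses-∷ : ∀ (i j : Fin m) (u v : Vertex n m) → crosses ℓ (i ∷ u) (j ∷ v) ≡
    𝟙 (i == j) * (In (i ∷ u) * Out (j ∷ v) * 𝟙 (adjacent u v))
    + 𝟙 (isReplicate v i) * (𝟙 (not (i == j)) * 𝟙 (isReplicate u j) * In (i ∷ u) * Out (j ∷ v))
  crosses-∷ i j u v =
    trans (cong (In (i ∷ u) * Out (j ∷ v) *_) (𝟙-adjacent-∷ i j u v))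
          (distrib (In (i ∷ u)) (Out (j ∷ v)) (𝟙 (i == j)) (𝟙 (adjacent u v)) (𝟙 (not (i == j))) (𝟙 (isReplicate u j)) (𝟙 (isReplicate v i)))
    where
    distrib : ∀ a b e c f g h → a * b * (e * c + f * (g * h)) ≡ e * (a * b * c) + h * (f * g * a * b)
    distrib = solve-∀

  ∑-crosses-∷ : ∀ (i : Fin m) (u : Vertex n m) →
    ∑ (crosses ℓ (i ∷ u)) (allVertices (suc n) m) ≡ ∑ (within i u) V + ∑ (λ j → bridge i j u) (allFin m)
  ∑-crosses-∷ i u = begin
    ∑ (crosses ℓ (i ∷ u)) (allVertices (suc n) m)
      ≡⟨ ∑-allVertices-suc (crosses ℓ (i ∷ u)) ⟩
    ∑ (λ j → ∑ (λ v → crosses ℓ (i ∷ u) (j ∷ v)) V) (allFin m)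
      ≡⟨ ∑-cong (λ j → ∑-cong (crosses-∷ i j u) V) (allFin m) ⟩
    ∑ (λ j → ∑ (λ v → 𝟙 (i == j) * within′ j v + 𝟙 (isReplicate v i) * bridge′ j v) V) (allFin m)
      ≡⟨ ∑∑-+ _ _ (allFin m) V ⟩
    ∑ (λ j → ∑ (λ v → 𝟙 (i == j) * within′ j v) V) (allFin m)
      + ∑ (λ j → ∑ (λ v → 𝟙 (isReplicate v i) * bridge′ j v) V) (allFin m)
      ≡⟨ cong₂ _+_ (trans (∑-cong (λ j → ∑-*ˡ (𝟙 (i == j)) (within′ j) V) (allFin m)) (∑-delta′ i (λ j → ∑ (within′ j) V)))
                   (∑-cong (λ j → ∑-isReplicate i (bridge′ j)) (allFin m)) ⟩
    ∑ (within i u) V + ∑ (λ j → bridge i j u) (allFin m) ∎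
    where
    open ≡-Reasoning
    within′ : Fin m → Vertex n m → ℕ
    within′ j v = In (i ∷ u) * Out (j ∷ v) * 𝟙 (adjacent u v)
    bridge′ : Fin m → Vertex n m → ℕ
    bridge′ j v = 𝟙 (not (i == j)) * 𝟙 (isReplicate u j) * In (i ∷ u) * Out (j ∷ v)

  boundary-suc : boundary (suc n) m ℓ ≡ ∑ (λ i → boundary n m (ℓ ∸ toℕ i * m ^ n)) (allFin m) + bridges n m ℓ
  boundary-suc = begin
    boundary (suc n) m ℓ
      ≡⟨ ∑-allVertices-suc (λ w → ∑ (crosses ℓ w) (allVertices (suc n) m)) ⟩
    ∑ (λ i → ∑ (λ u → ∑ (crosses ℓ (i ∷ u)) (allVertices (suc n) m)) V) (allFin m)
      ≡⟨ ∑-cong (λ i → ∑-cong (∑-crosses-∷ i) V) (allFin m) ⟩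
    ∑ (λ i → ∑ (λ u → ∑ (within i u) V + ∑ (λ j → bridge i j u) (allFin m)) V) (allFin m)
      ≡⟨ ∑∑-+ _ _ (allFin m) V ⟩
    ∑ (λ i → ∑ (λ u → ∑ (within i u) V) V) (allFin m) + ∑ (λ i → ∑ (λ u → ∑ (λ j → bridge i j u) (allFin m)) V) (allFin m)
      ≡⟨ cong₂ _+_ (∑-cong withinCopy (allFin m)) (∑-cong betweenCopies (allFin m)) ⟩
    ∑ (λ i → boundary n m (ℓ ∸ toℕ i * m ^ n)) (allFin m) + bridges n m ℓ ∎
    where
    open ≡-Reasoning
    withinCopy : ∀ (i : Fin m) → ∑ (λ u → ∑ (within i u) V) V ≡ boundary n m (ℓ ∸ toℕ i * m ^ n)
    withinCopy i = ∑-cong (λ u → ∑-cong (λ v →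
      cong₂ (λ a b → 𝟙 a * 𝟙 (not b) * 𝟙 (adjacent u v)) (inLex⁻¹-∷ ℓ i u) (inLex⁻¹-∷ ℓ i v)) V) V
    betweenCopies : ∀ (i : Fin m) → ∑ (λ u → ∑ (λ j → bridge i j u) (allFin m)) V
                        ≡ ∑ (λ j → 𝟙 (not (i == j)) * In (i ∷ replicate n j) * Out (j ∷ replicate n i)) (allFin m)
    betweenCopies i = trans (∑-swap (λ u j → bridge i j u) V (allFin m)) (∑-cong (λ j →
      trans (∑-cong (λ u → reorder (𝟙 (not (i == j))) (𝟙 (isReplicate u j)) (In (i ∷ u)) (Out (j ∷ replicate n i))) V)
            (∑-isReplicate j (λ (u : Vertex n m) → 𝟙 (not (i == j)) * In (i ∷ u) * Out (j ∷ replicate n i)))) (allFin m))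
      where
      reorder : ∀ a b c d → a * b * c * d ≡ b * (a * c * d)
      reorder = solve-∀

-- Corner vertices, q, and the recursions for θ and q

repunit : ℕ → ℕ → ℕ
repunit m zero = 0
repunit m (suc n) = m ^ n + repunit m n

module _ (m : ℕ) where

  lexVal<m^n : ∀ {n} (u : Vertex n m) → lexVal u < m ^ n
  lexVal<m^n {zero} [] = s≤s z≤n
  lexVal<m^n {suc n} (x ∷ xs) = begin-strict
    toℕ x * m ^ n + lexVal xs  <⟨ +-monoʳ-< (toℕ x * m ^ n) (lexVal<m^n xs) ⟩
    toℕ x * m ^ n + m ^ n      ≡⟨ +-comm (toℕ x * m ^ n) (m ^ n) ⟩
    suc (toℕ x) * m ^ n        ≤⟨ *-monoˡ-≤ (m ^ n) (Fin.toℕ<n x) ⟩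
    m * m ^ n                  ∎
    where open ≤-Reasoning

  lexVal-replicate : ∀ n (j : Fin m) → lexVal (replicate n j) ≡ toℕ j * repunit m n
  lexVal-replicate zero j = sym (*-zeroʳ (toℕ j))
  lexVal-replicate (suc n) j =
    trans (cong (toℕ j * m ^ n +_) (lexVal-replicate n j)) (sym (*-distribˡ-+ (toℕ j) (m ^ n) (repunit m n)))

  corner<m^n : ∀ n j → j < m → j * repunit m n < m ^ n
  corner<m^n n j j<m =
    subst (_< m ^ n) (trans (lexVal-replicate n (fromℕ< j<m)) (cong (_* repunit m n) (Fin.toℕ-fromℕ< j<m)))
          (lexVal<m^n (replicate n (fromℕ< j<m)))

  boundary-full : ∀ n ℓ → m ^ n ≤ ℓ → boundary n m ℓ ≡ 0
  boundary-full n ℓ m^n≤ℓ =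
    ∑-zero _ (λ u → ∑-zero _ (λ v → cong₂ (λ a b → 𝟙 a * 𝟙 (not b) * 𝟙 (adjacent u v)) (inside u) (inside v)) V) V
    where
    V = allVertices n m
    inside : ∀ w → inLex⁻¹ ℓ w ≡ true
    inside w = ≤⇒≤ᵇ≡true (≤-trans (lexVal<m^n w) m^n≤ℓ)

  boundary-empty : ∀ n → boundary n m 0 ≡ 0
  boundary-empty n = ∑-zero _ (λ _ → ∑-zero _ (λ _ → refl) (allVertices n m)) (allVertices n m)

  -- cornerIn n r j says jⁿ ∈ Lex⁻¹(n,m;r), with the digit j given as a number.
  cornerIn : ℕ → ℕ → ℕ → Bool
  cornerIn n r j = suc (j * repunit m n) ≤ᵇ r

  q≡∑<-cornerIn : ∀ n r → q n m r ≡ ∑< m (𝟙 ∘ cornerIn n r)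
  q≡∑<-cornerIn n r =
    trans (length-filterᵇ _ (allFin m))
          (trans (∑-cong (λ i → cong (λ t → 𝟙 (suc t ≤ᵇ r)) (lexVal-replicate n i)) (allFin m))
                 (∑-allFin≡∑< m (𝟙 ∘ cornerIn n r)))

  q≤m : ∀ n r → q n m r ≤ m
  q≤m n r = subst (_≤ m) (sym (q≡∑<-cornerIn n r)) (∑<-𝟙≤ m (cornerIn n r))

  cornerIn-threshold : ∀ n r j → j < m → cornerIn n r j ≡ (j <ᵇ q n m r)
  cornerIn-threshold n r j j<m =
    trans (downClosed-threshold m (cornerIn n r) downClosed j j<m) (cong (j <ᵇ_) (sym (q≡∑<-cornerIn n r)))
    where
    downClosed : DownClosed (cornerIn n r)
    downClosed i j i≤j inⱼ = <⇒<ᵇ≡true (≤-<-trans (*-monoˡ-≤ (repunit m n) i≤j) (<ᵇ≡true⇒< _ r inⱼ))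

  q-mono : ∀ n {r r′} → r ≤ r′ → q n m r ≤ q n m r′
  q-mono n {r} {r′} r≤r′ rewrite q≡∑<-cornerIn n r | q≡∑<-cornerIn n r′ =
    ∑<-mono m (λ j _ → 𝟙-mono (λ inⱼ → ≤⇒≤ᵇ≡true (≤-trans (<ᵇ≡true⇒< _ r inⱼ) r≤r′)))

-- A bridge from copy i to copy j is cut by Lex⁻¹(k·mⁿ + r) iff i < k < j, or i < k = j and
-- iⁿ ∉ Lex⁻¹(r) (i.e. x ≤ i for x = qₙ(r)), or i = k < j and jⁿ ∈ Lex⁻¹(r).
𝟙-bridge : ∀ i j k x →
    𝟙 (not (i ≡ᵇ j)) * 𝟙 ((i <ᵇ k) ∨ ((i ≡ᵇ k) ∧ (j <ᵇ x))) * 𝟙 (not ((j <ᵇ k) ∨ ((j ≡ᵇ k) ∧ (i <ᵇ x))))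
  ≡ 𝟙 (i <ᵇ k) * 𝟙 (k <ᵇ j) + 𝟙 (i <ᵇ k) * (𝟙 (j ≡ᵇ k) * 𝟙 (x ≤ᵇ i)) + 𝟙 (i ≡ᵇ k) * (𝟙 (k <ᵇ j) * 𝟙 (j <ᵇ x))
𝟙-bridge i j k x with <-cmp i k | <-cmp j k
... | tri< i<k _ _ | tri< j<k _ _
  rewrite <⇒<ᵇ≡true i<k | <⇒<ᵇ≡true j<k | ≥⇒<ᵇ≡false (<⇒≤ j<k) | ≢⇒≡ᵇ≡false (<⇒≢ i<k) | ≢⇒≡ᵇ≡false (<⇒≢ j<k)
  with i ≡ᵇ j
...   | true = refl
...   | false = refl
𝟙-bridge i j k x | tri< i<k _ _ | tri≈ _ refl _
  rewrite <⇒<ᵇ≡true i<k | ≥⇒<ᵇ≡false {j} ≤-refl | ≡ᵇ-refl j | ≢⇒≡ᵇ≡false (<⇒≢ i<k) | sym (not-<ᵇ i x)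
  with i <ᵇ x
...   | true = refl
...   | false = refl
𝟙-bridge i j k x | tri< i<k _ _ | tri> _ _ k<j
  rewrite <⇒<ᵇ≡true i<k | <⇒<ᵇ≡true k<j | ≥⇒<ᵇ≡false (<⇒≤ k<j) | ≢⇒≡ᵇ≡false (<⇒≢ i<k)
        | ≢⇒≡ᵇ≡false (<⇒≢ k<j ∘ sym) | ≢⇒≡ᵇ≡false {i} {j} (<⇒≢ (<-trans i<k k<j)) = refl
𝟙-bridge i j k x | tri≈ _ refl _ | tri< j<k _ _
  rewrite <⇒<ᵇ≡true j<k | ≥⇒<ᵇ≡false {i} ≤-refl | ≥⇒<ᵇ≡false (<⇒≤ j<k) | ≡ᵇ-refl i
  with i ≡ᵇ j | j <ᵇ x
... | true | true = refl
... | true | false = refl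
... | false | true = refl
... | false | false = refl
𝟙-bridge i j k x | tri≈ _ refl _ | tri≈ _ refl _ rewrite ≥⇒<ᵇ≡false {i} ≤-refl | ≡ᵇ-refl i = refl
𝟙-bridge i j k x | tri≈ _ refl _ | tri> _ _ k<j
  rewrite <⇒<ᵇ≡true k<j | ≥⇒<ᵇ≡false {i} ≤-refl | ≥⇒<ᵇ≡false (<⇒≤ k<j) | ≡ᵇ-refl i
        | ≢⇒≡ᵇ≡false (<⇒≢ k<j ∘ sym) | ≢⇒≡ᵇ≡false {i} {j} (<⇒≢ k<j)
  with j <ᵇ x
... | true = refl
... | false = refl
𝟙-bridge i j k x | tri> _ _ k<i | _ rewrite ≥⇒<ᵇ≡false (<⇒≤ k<i) | ≢⇒≡ᵇ≡false (<⇒≢ k<i ∘ sym) with i ≡ᵇ j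
... | true = refl
... | false = refl

∑∑-bridge : ∀ m k x → k < m → x ≤ m →
  ∑< m (λ i → ∑< m (λ j →
    𝟙 (i <ᵇ k) * 𝟙 (k <ᵇ j) + 𝟙 (i <ᵇ k) * (𝟙 (j ≡ᵇ k) * 𝟙 (x ≤ᵇ i)) + 𝟙 (i ≡ᵇ k) * (𝟙 (k <ᵇ j) * 𝟙 (j <ᵇ x))))
  ≡ k * (m ∸ suc k) + (k ∸ x) + (x ∸ suc k)
∑∑-bridge m k x k<m x≤m = begin
  ∑< m (λ i → ∑< m (λ j → belowToAbove i j + belowToCopy i j + copyToAbove i j))
    ≡⟨ ∑<-cong m (λ i _ → trans (∑<-+ m _ (copyToAbove i)) (cong (_+ ∑< m (copyToAbove i)) (∑<-+ m (belowToAbove i) (belowToCopy i)))) ⟩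
  ∑< m (λ i → ∑< m (belowToAbove i) + ∑< m (belowToCopy i) + ∑< m (copyToAbove i))
    ≡⟨ trans (∑<-+ m _ (λ i → ∑< m (copyToAbove i)))
             (cong (_+ ∑< m (λ i → ∑< m (copyToAbove i))) (∑<-+ m (λ i → ∑< m (belowToAbove i)) (λ i → ∑< m (belowToCopy i)))) ⟩
  ∑< m (λ i → ∑< m (belowToAbove i)) + ∑< m (λ i → ∑< m (belowToCopy i)) + ∑< m (λ i → ∑< m (copyToAbove i))
    ≡⟨ cong₂ _+_ (cong₂ _+_ ∑belowToAbove ∑belowToCopy) ∑copyToAbove ⟩
  k * (m ∸ suc k) + (k ∸ x) + (x ∸ suc k) ∎
  where
  open ≡-Reasoning
  belowToAbove belowToCopy copyToAbove : ℕ → ℕ → ℕ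
  belowToAbove i j = 𝟙 (i <ᵇ k) * 𝟙 (k <ᵇ j)
  belowToCopy i j = 𝟙 (i <ᵇ k) * (𝟙 (j ≡ᵇ k) * 𝟙 (x ≤ᵇ i))
  copyToAbove i j = 𝟙 (i ≡ᵇ k) * (𝟙 (k <ᵇ j) * 𝟙 (j <ᵇ x))
  k⊓m≡k : k ⊓ m ≡ k
  k⊓m≡k = m≤n⇒m⊓n≡m (<⇒≤ k<m)
  ∑belowToAbove : ∑< m (λ i → ∑< m (belowToAbove i)) ≡ k * (m ∸ suc k)
  ∑belowToAbove =
    trans (∑<-cong m (λ i _ → trans (∑<-*ˡ m (𝟙 (i <ᵇ k)) _) (cong (𝟙 (i <ᵇ k) *_) (∑<->ᵇ m k))))
          (trans (∑<-*ʳ m (m ∸ suc k) (λ i → 𝟙 (i <ᵇ k))) (cong (_* (m ∸ suc k)) (trans (∑<-<ᵇ m k) k⊓m≡k)))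
  atCopy : ∀ i → ∑< m (belowToCopy i) ≡ 𝟙 (x ≤ᵇ i) * 𝟙 (i <ᵇ k)
  atCopy i = begin
    ∑< m (belowToCopy i)                                   ≡⟨ ∑<-cong m (λ j _ → reorder (𝟙 (i <ᵇ k)) (𝟙 (j ≡ᵇ k)) (𝟙 (x ≤ᵇ i))) ⟩
    ∑< m (λ j → 𝟙 (j ≡ᵇ k) * (𝟙 (x ≤ᵇ i) * 𝟙 (i <ᵇ k)))   ≡⟨ ∑<-delta m k _ k<m ⟩
    𝟙 (x ≤ᵇ i) * 𝟙 (i <ᵇ k)                               ∎
    where
    reorder : ∀ a d e → a * (d * e) ≡ d * (e * a)
    reorder = solve-∀
  ∑belowToCopy : ∑< m (λ i → ∑< m (belowToCopy i)) ≡ k ∸ x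
  ∑belowToCopy = trans (∑<-cong m (λ i _ → atCopy i)) (trans (∑<-interval m x k) (cong (_∸ x) k⊓m≡k))
  ∑copyToAbove : ∑< m (λ i → ∑< m (copyToAbove i)) ≡ x ∸ suc k
  ∑copyToAbove =
    trans (∑<-cong m (λ i _ → ∑<-*ˡ m (𝟙 (i ≡ᵇ k)) (λ j → 𝟙 (k <ᵇ j) * 𝟙 (j <ᵇ x))))
          (trans (∑<-delta m k (λ _ → ∑< m (λ j → 𝟙 (k <ᵇ j) * 𝟙 (j <ᵇ x))) k<m)
                 (trans (∑<-interval m (suc k) x) (cong (_∸ suc k) (m≤n⇒m⊓n≡m x≤m))))

∑<-lexLess-corner : ∀ m k x → k < m → ∑< m (λ i → 𝟙 ((i <ᵇ k) ∨ ((i ≡ᵇ k) ∧ (i <ᵇ x)))) ≡ k + 𝟙 (k <ᵇ x)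
∑<-lexLess-corner m k x k<m =
  trans (∑<-cong m (λ i _ → split i))
        (trans (∑<-+ m (λ i → 𝟙 (i <ᵇ k)) (λ i → 𝟙 (i ≡ᵇ k) * 𝟙 (i <ᵇ x)))
               (cong₂ _+_ (trans (∑<-<ᵇ m k) (m≤n⇒m⊓n≡m (<⇒≤ k<m))) (∑<-delta m k (λ i → 𝟙 (i <ᵇ x)) k<m)))
  where
  split : ∀ i → 𝟙 ((i <ᵇ k) ∨ ((i ≡ᵇ k) ∧ (i <ᵇ x))) ≡ 𝟙 (i <ᵇ k) + 𝟙 (i ≡ᵇ k) * 𝟙 (i <ᵇ x)
  split i with <-cmp i k
  ... | tri< i<k _ _ rewrite <⇒<ᵇ≡true i<k | ≢⇒≡ᵇ≡false (<⇒≢ i<k) = refl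
  ... | tri≈ _ refl _ rewrite ≥⇒<ᵇ≡false {i} ≤-refl | ≡ᵇ-refl i = sym (+-identityʳ (𝟙 (i <ᵇ x)))
  ... | tri> _ _ k<i rewrite ≥⇒<ᵇ≡false (<⇒≤ k<i) | ≢⇒≡ᵇ≡false (<⇒≢ k<i ∘ sym) = refl

module _ (m : ℕ) where

  corner-block : ∀ n k r i j → r ≤ m ^ n → j < m →
    (suc (i * m ^ n + j * repunit m n) ≤ᵇ k * m ^ n + r) ≡ ((i <ᵇ k) ∨ ((i ≡ᵇ k) ∧ (j <ᵇ q n m r)))
  corner-block n k r i j r≤M j<m =
    trans (block-≤ᵇ (m ^ n) k r i (j * repunit m n) r≤M (corner<m^n m n j j<m))
          (cong (λ b → (i <ᵇ k) ∨ ((i ≡ᵇ k) ∧ b)) (cornerIn-threshold m n r j j<m))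

  ∑-boundary-copies : ∀ n k r → k < m → r ≤ m ^ n →
    ∑ (λ i → boundary n m (k * m ^ n + r ∸ toℕ i * m ^ n)) (allFin m) ≡ boundary n m r
  ∑-boundary-copies n k r k<m r≤M =
    trans (∑-allFin≡∑< m (λ i → boundary n m (k * M + r ∸ i * M)))
          (trans (∑<-single m k _ k<m otherCopy) (cong (boundary n m) (m+n∸m≡n (k * M) r)))
    where
    M = m ^ n
    otherCopy : ∀ i → i < m → i ≢ k → boundary n m (k * M + r ∸ i * M) ≡ 0
    otherCopy i _ i≢k with <-cmp i k
    ... | tri< i<k _ _ = boundary-full m n _ (begin
      M                      ≡⟨ sym (m+n∸m≡n (i * M) M) ⟩
      i * M + M ∸ i * M      ≤⟨ ∸-monoˡ-≤ (i * M) (begin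
                                  i * M + M  ≡⟨ +-comm (i * M) M ⟩
                                  suc i * M  ≤⟨ *-monoˡ-≤ M i<k ⟩
                                  k * M      ≤⟨ m≤m+n (k * M) r ⟩
                                  k * M + r  ∎) ⟩
      k * M + r ∸ i * M      ∎)
      where open ≤-Reasoning
    ... | tri≈ _ i≡k _ = ⊥-elim (i≢k i≡k)
    ... | tri> _ _ k<i = trans (cong (boundary n m) (m≤n⇒m∸n≡0 (begin
      k * M + r  ≤⟨ +-monoʳ-≤ (k * M) r≤M ⟩
      k * M + M  ≡⟨ +-comm (k * M) M ⟩
      suc k * M  ≤⟨ *-monoˡ-≤ M k<i ⟩
      i * M      ∎))) (boundary-empty m n)
      where open ≤-Reasoning

  q-suc : ∀ n k r → k < m → r ≤ m ^ n → q (suc n) m (k * m ^ n + r) ≡ k + 𝟙 (k <ᵇ q n m r)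
  q-suc n k r k<m r≤M = begin
    q (suc n) m ℓ
      ≡⟨ length-filterᵇ _ (allFin m) ⟩
    ∑ (λ i → 𝟙 (suc (toℕ i * m ^ n + lexVal (replicate n i)) ≤ᵇ ℓ)) (allFin m)
      ≡⟨ ∑-cong (λ i → cong (λ t → 𝟙 (suc (toℕ i * m ^ n + t) ≤ᵇ ℓ)) (lexVal-replicate m n i)) (allFin m) ⟩
    ∑ (λ i → 𝟙 (suc (toℕ i * m ^ n + toℕ i * repunit m n) ≤ᵇ ℓ)) (allFin m)
      ≡⟨ ∑-allFin≡∑< m (λ i → 𝟙 (suc (i * m ^ n + i * repunit m n) ≤ᵇ ℓ)) ⟩
    ∑< m (λ i → 𝟙 (suc (i * m ^ n + i * repunit m n) ≤ᵇ ℓ))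
      ≡⟨ ∑<-cong m (λ i i<m → cong 𝟙 (corner-block n k r i i r≤M i<m)) ⟩
    ∑< m (λ i → 𝟙 ((i <ᵇ k) ∨ ((i ≡ᵇ k) ∧ (i <ᵇ q n m r))))
      ≡⟨ ∑<-lexLess-corner m k (q n m r) k<m ⟩
    k + 𝟙 (k <ᵇ q n m r) ∎
    where
    open ≡-Reasoning
    ℓ = k * m ^ n + r

  bridges-value : ∀ n k r → k < m → r ≤ m ^ n →
    bridges n m (k * m ^ n + r) ≡ k * (m ∸ suc k) + (k ∸ q n m r) + (q n m r ∸ suc k)
  bridges-value n k r k<m r≤M = begin
    bridges n m ℓ
      ≡⟨ ∑-cong (λ i → trans (∑-cong (onNumbers i) (allFin m)) (∑-allFin≡∑< m (bridgeℕ (toℕ i)))) (allFin m) ⟩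
    ∑ (λ i → ∑< m (bridgeℕ (toℕ i))) (allFin m)
      ≡⟨ ∑-allFin≡∑< m (λ i → ∑< m (bridgeℕ i)) ⟩
    ∑< m (λ i → ∑< m (bridgeℕ i))
      ≡⟨ ∑<-cong m (λ i i<m → ∑<-cong m (λ j j<m → trans (byBlocks i j i<m j<m) (𝟙-bridge i j k x))) ⟩
    _ ≡⟨ ∑∑-bridge m k x k<m (q≤m m n r) ⟩
    k * (m ∸ suc k) + (k ∸ x) + (x ∸ suc k) ∎
    where
    open ≡-Reasoning
    M = m ^ n
    ℓ = k * M + r
    x = q n m r
    bridgeℕ : ℕ → ℕ → ℕ
    bridgeℕ i j = 𝟙 (not (i ≡ᵇ j)) * 𝟙 (suc (i * M + j * repunit m n) ≤ᵇ ℓ) * 𝟙 (not (suc (j * M + i * repunit m n) ≤ᵇ ℓ))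
    onNumbers : ∀ (i j : Fin m) →
      𝟙 (not (i == j)) * 𝟙 (inLex⁻¹ ℓ (i ∷ replicate n j)) * 𝟙 (not (inLex⁻¹ ℓ (j ∷ replicate n i))) ≡ bridgeℕ (toℕ i) (toℕ j)
    onNumbers i j =
      cong₂ _*_ (cong₂ _*_ (cong (𝟙 ∘ not) (==-toℕ i j))
                           (cong (λ t → 𝟙 (suc (toℕ i * M + t) ≤ᵇ ℓ)) (lexVal-replicate m n j)))
                (cong (λ t → 𝟙 (not (suc (toℕ j * M + t) ≤ᵇ ℓ))) (lexVal-replicate m n i))
    byBlocks : ∀ i j → i < m → j < m →
      bridgeℕ i j ≡ 𝟙 (not (i ≡ᵇ j)) * 𝟙 ((i <ᵇ k) ∨ ((i ≡ᵇ k) ∧ (j <ᵇ x))) * 𝟙 (not ((j <ᵇ k) ∨ ((j ≡ᵇ k) ∧ (i <ᵇ x))))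
    byBlocks i j i<m j<m =
      cong₂ _*_ (cong (𝟙 (not (i ≡ᵇ j)) *_) (cong 𝟙 (corner-block n k r i j r≤M j<m)))
                (cong (𝟙 ∘ not) (corner-block n k r j i r≤M i<m))

  thetaLex-suc : ∀ n k r → k < m → r ≤ m ^ n →
    thetaLex (suc n) m (k * m ^ n + r) ≡ thetaLex n m r + (k * (m ∸ suc k) + (k ∸ q n m r) + (q n m r ∸ suc k))
  thetaLex-suc n k r k<m r≤M = begin
    thetaLex (suc n) m ℓ
      ≡⟨ thetaLex≡boundary (suc n) m ℓ ⟩
    boundary (suc n) m ℓ
      ≡⟨ boundary-suc n m ℓ ⟩
    ∑ (λ i → boundary n m (ℓ ∸ toℕ i * m ^ n)) (allFin m) + bridges n m ℓ
      ≡⟨ cong₂ _+_ (trans (∑-boundary-copies n k r k<m r≤M) (sym (thetaLex≡boundary n m r))) (bridges-value n k r k<m r≤M) ⟩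
    thetaLex n m r + (k * (m ∸ suc k) + (k ∸ q n m r) + (q n m r ∸ suc k)) ∎
    where
    open ≡-Reasoning
    ℓ = k * m ^ n + r

-- Inequalities between leading digits

q⁺ : ℕ → ℕ → ℕ
q⁺ k x = k + 𝟙 (k <ᵇ x)

q⁺≤x+k∸x : ∀ k x → q⁺ k x ≤ x + (k ∸ x)
q⁺≤x+k∸x k x with <-cmp k x
... | tri< k<x _ _ rewrite <⇒<ᵇ≡true k<x | m≤n⇒m∸n≡0 (<⇒≤ k<x) | +-identityʳ x = ≤-trans (≤-reflexive (+-comm k 1)) k<x
... | tri≈ _ refl _ rewrite ≥⇒<ᵇ≡false {k} ≤-refl | n∸n≡0 k = ≤-refl
... | tri> _ _ x<k rewrite ≥⇒<ᵇ≡false (<⇒≤ x<k) | m+[n∸m]≡n (<⇒≤ x<k) = ≤-reflexive (+-identityʳ k)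

q⁺≤1+k : ∀ k x → q⁺ k x ≤ suc k
q⁺≤1+k k x = ≤-trans (+-monoʳ-≤ k (𝟙≤1 (k <ᵇ x))) (≤-reflexive (+-comm k 1))

q⁺-≥ : ∀ k x → x ≤ k → q⁺ k x ≡ k
q⁺-≥ k x x≤k rewrite ≥⇒<ᵇ≡false x≤k = +-identityʳ k

q⁺⊓q⁺≤ : ∀ k k′ x x′ → q⁺ k x ⊓ q⁺ k′ x′ ≤ (x ⊓ x′) + (k ∸ x) + (k′ ∸ x′)
q⁺⊓q⁺≤ k k′ x x′ with ≤-total x x′
... | inj₁ x≤x′ rewrite m≤n⇒m⊓n≡m x≤x′ = ≤-trans (m⊓n≤m _ _) (≤-trans (q⁺≤x+k∸x k x) (m≤m+n _ _))
... | inj₂ x′≤x rewrite m≥n⇒m⊓n≡n x′≤x =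
  ≤-trans (m⊓n≤n _ _) (≤-trans (q⁺≤x+k∸x k′ x′) (+-monoˡ-≤ (k′ ∸ x′) (m≤m+n x′ (k ∸ x))))

⊓≤* : ∀ a b → a ⊓ b ≤ a * b
⊓≤* zero b = z≤n
⊓≤* (suc a) zero = z≤n
⊓≤* (suc a) (suc b) = ≤-trans (m⊓n≤m (suc a) (suc b)) (m≤m*n (suc a) (suc b))

zeroDigit-core : ∀ k′ x x′ z → x ≤ z → x′ ≤ z → (k′ ∸ z) + (q⁺ 0 x ⊓ q⁺ k′ x′) ≤ (x ⊓ x′) + (k′ ∸ x′)
zeroDigit-core k′ zero x′ z _ x′≤z = ≤-trans (≤-reflexive (+-identityʳ _)) (∸-monoʳ-≤ k′ x′≤z)
zeroDigit-core zero (suc x) zero z (s≤s _) _ = z≤n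
zeroDigit-core (suc k′) (suc x) zero (suc z) _ _ = ≤-trans (≤-reflexive (+-comm _ 1)) (s≤s (m∸n≤m k′ z))
zeroDigit-core k′ (suc x) (suc x′) z _ x′≤z =
  ≤-trans (+-mono-≤ (∸-monoʳ-≤ k′ x′≤z) (≤-trans (m⊓n≤m 1 _) (s≤s (z≤n {x ⊓ x′})))) (≤-reflexive (+-comm (k′ ∸ suc x′) (suc (x ⊓ x′))))

below-noCarry-core : ∀ k k′ x x′ z → x ≤ z → x′ ≤ z →
  (k + k′ ∸ z) + (q⁺ k x ⊓ q⁺ k′ x′) ≤ (x ⊓ x′) + k * k′ + (k ∸ x) + (k′ ∸ x′)
below-noCarry-core k k′ x x′ zero x≤0 x′≤0
  rewrite n≤0⇒n≡0 x≤0 | n≤0⇒n≡0 x′≤0 | +-identityʳ k | +-identityʳ k′ = begin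
  k + k′ + (k ⊓ k′)  ≤⟨ +-monoʳ-≤ (k + k′) (⊓≤* k k′) ⟩
  k + k′ + k * k′    ≡⟨ reorder k k′ ⟩
  k * k′ + k + k′    ∎
  where
  open ≤-Reasoning
  reorder : ∀ a b → a + b + a * b ≡ a * b + a + b
  reorder = solve-∀
below-noCarry-core zero k′ x x′ (suc z) x≤z x′≤z rewrite 0∸n≡0 x | +-identityʳ (x ⊓ x′) | +-identityʳ (x ⊓ x′) =
  zeroDigit-core k′ x x′ (suc z) x≤z x′≤z
below-noCarry-core (suc k) zero x x′ (suc z) x≤z x′≤z
  rewrite +-identityʳ k | 0∸n≡0 x′ | *-zeroʳ k | +-identityʳ (x ⊓ x′) | +-identityʳ (x ⊓ x′ + (suc k ∸ x)) =
  subst₂ (λ a b → (k ∸ z) + a ≤ b + (suc k ∸ x)) (⊓-comm (q⁺ 0 x′) _) (⊓-comm x′ x)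
         (zeroDigit-core (suc k) x′ x (suc z) x′≤z x≤z)
below-noCarry-core (suc k) (suc k′) x x′ (suc z) x≤z x′≤z = begin
  (suc k + suc k′ ∸ suc z) + (q⁺ (suc k) x ⊓ q⁺ (suc k′) x′)
    ≤⟨ +-mono-≤ (∸-monoʳ-≤ {1} {suc z} (suc k + suc k′) (s≤s z≤n)) (q⁺⊓q⁺≤ (suc k) (suc k′) x x′) ⟩
  (k + suc k′) + ((x ⊓ x′) + (suc k ∸ x) + (suc k′ ∸ x′))
    ≤⟨ +-monoˡ-≤ _ (≤-trans (≤-reflexive (+-comm k (suc k′))) (+-monoʳ-≤ (suc k′) (m≤m*n k (suc k′)))) ⟩
  suc k * suc k′ + ((x ⊓ x′) + (suc k ∸ x) + (suc k′ ∸ x′))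
    ≡⟨ reorder (suc k * suc k′) (x ⊓ x′) (suc k ∸ x) (suc k′ ∸ x′) ⟩
  (x ⊓ x′) + suc k * suc k′ + (suc k ∸ x) + (suc k′ ∸ x′) ∎
  where
  open ≤-Reasoning
  reorder : ∀ p a b c → p + (a + b + c) ≡ a + p + b + c
  reorder = solve-∀

m⊓n+m⊔n≡m+n : ∀ a b → (a ⊓ b) + (a ⊔ b) ≡ a + b
m⊓n+m⊔n≡m+n a b with ≤-total a b
... | inj₁ a≤b rewrite m≤n⇒m⊓n≡m a≤b | m≤n⇒m⊔n≡n a≤b = refl
... | inj₂ b≤a rewrite m≥n⇒m⊓n≡n b≤a | m≥n⇒m⊔n≡m b≤a = +-comm b a

below-carry-core : ∀ k k′ x x′ z → z ≤ x → z ≤ x′ →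
  (suc (k + k′) ∸ z) + z + (q⁺ k x ⊓ q⁺ k′ x′) ≤ (x ⊓ x′) + k * k′ + k + k′ + 1 + (k ∸ x) + (k′ ∸ x′)
below-carry-core k k′ x x′ z z≤x z≤x′ with ≤-total z (suc (k + k′))
... | inj₁ z≤K rewrite m∸n+n≡m z≤K = begin
    suc (k + k′) + (q⁺ k x ⊓ q⁺ k′ x′) ≤⟨ +-monoʳ-≤ (suc (k + k′)) (q⁺⊓q⁺≤ k k′ x x′) ⟩
    suc (k + k′) + ((x ⊓ x′) + (k ∸ x) + (k′ ∸ x′)) ≤⟨ +-monoʳ-≤ (suc (k + k′)) (m≤m+n _ (k * k′)) ⟩
    suc (k + k′) + ((x ⊓ x′) + (k ∸ x) + (k′ ∸ x′) + k * k′) ≡⟨ reorder k k′ (x ⊓ x′) (k ∸ x) (k′ ∸ x′) ⟩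
    (x ⊓ x′) + k * k′ + k + k′ + 1 + (k ∸ x) + (k′ ∸ x′) ∎
  where
  open ≤-Reasoning
  reorder : ∀ k k′ p a b → suc (k + k′) + (p + a + b + k * k′) ≡ p + k * k′ + k + k′ + 1 + a + b
  reorder = solve-∀
... | inj₂ K≤z rewrite m≤n⇒m∸n≡0 K≤z = begin
    z + (q⁺ k x ⊓ q⁺ k′ x′) ≤⟨ +-mono-≤ (⊓-glb z≤x z≤x′) (≤-trans (m⊓n≤m _ _) (q⁺≤1+k k x)) ⟩
    (x ⊓ x′) + suc k ≤⟨ m≤m+n _ (k * k′ + k′ + (k ∸ x) + (k′ ∸ x′)) ⟩
    (x ⊓ x′) + suc k + (k * k′ + k′ + (k ∸ x) + (k′ ∸ x′)) ≡⟨ reorder k k′ (x ⊓ x′) (k ∸ x) (k′ ∸ x′) ⟩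
    (x ⊓ x′) + k * k′ + k + k′ + 1 + (k ∸ x) + (k′ ∸ x′) ∎
  where
  open ≤-Reasoning
  reorder : ∀ k k′ p a b → p + suc k + (k * k′ + k′ + a + b) ≡ p + k * k′ + k + k′ + 1 + a + b
  reorder = solve-∀

above-noCarry-core-≤ : ∀ K s t x x′ z → x ≤ z → x′ ≤ z → z ≤ K →
  (K ∸ z) + (q⁺ (K + 1 + s) x ⊓ q⁺ (K + 1 + t) x′) + 1 ≤ (x ⊓ x′) + s * t + (K + 1 + s ∸ x) + (K + 1 + t ∸ x′) + 𝟙 (K <ᵇ z)
above-noCarry-core-≤ K s t x x′ z x≤z x′≤z z≤K rewrite ≥⇒<ᵇ≡false z≤K = +-cancelʳ-≤ z _ _ (begin
    (K ∸ z) + (q⁺ k x ⊓ q⁺ k′ x′) + 1 + z ≡⟨ cong (λ w → (K ∸ z) + w + 1 + z) (cong₂ _⊓_ (q⁺-≥ k x x≤k) (q⁺-≥ k′ x′ x′≤k′)) ⟩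
    (K ∸ z) + (k ⊓ k′) + 1 + z ≡⟨ e1 (K ∸ z) z (k ⊓ k′) ⟩
    (K ∸ z) + z + ((k ⊓ k′) + 1) ≡⟨ cong (_+ ((k ⊓ k′) + 1)) (m∸n+n≡m z≤K) ⟩
    K + ((k ⊓ k′) + 1) ≤⟨ +-monoʳ-≤ K (+-monoˡ-≤ 1 (m⊓n≤m k k′)) ⟩
    K + (k + 1) ≤⟨ m≤m+n (K + (k + 1)) t ⟩
    K + (k + 1) + t ≡⟨ e2 K s t ⟩
    k + k′ ≡⟨ sym (cong₂ _+_ (m+[n∸m]≡n x≤k) (m+[n∸m]≡n x′≤k′)) ⟩
    (x + (k ∸ x)) + (x′ + (k′ ∸ x′)) ≡⟨ e3 x x′ (k ∸ x) (k′ ∸ x′) ⟩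
    (x + x′) + ((k ∸ x) + (k′ ∸ x′)) ≡⟨ cong (_+ ((k ∸ x) + (k′ ∸ x′))) (sym (m⊓n+m⊔n≡m+n x x′)) ⟩
    ((x ⊓ x′) + (x ⊔ x′)) + ((k ∸ x) + (k′ ∸ x′)) ≤⟨ +-monoˡ-≤ _ (+-monoʳ-≤ (x ⊓ x′) (⊔-lub x≤z x′≤z)) ⟩
    ((x ⊓ x′) + z) + ((k ∸ x) + (k′ ∸ x′)) ≤⟨ +-monoˡ-≤ _ (+-monoˡ-≤ z (m≤m+n (x ⊓ x′) (s * t))) ⟩
    ((x ⊓ x′) + s * t + z) + ((k ∸ x) + (k′ ∸ x′)) ≡⟨ e4 ((x ⊓ x′) + s * t) z (k ∸ x) (k′ ∸ x′) ⟩
    (x ⊓ x′) + s * t + (k ∸ x) + (k′ ∸ x′) + 0 + z ∎)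
  where
  open ≤-Reasoning
  k = K + 1 + s
  k′ = K + 1 + t
  x≤k : x ≤ k
  x≤k = ≤-trans x≤z (≤-trans z≤K (≤-trans (m≤m+n K 1) (m≤m+n (K + 1) s)))
  x′≤k′ : x′ ≤ k′
  x′≤k′ = ≤-trans x′≤z (≤-trans z≤K (≤-trans (m≤m+n K 1) (m≤m+n (K + 1) t)))
  e1 : ∀ a z b → a + b + 1 + z ≡ a + z + (b + 1)
  e1 = solve-∀
  e2 : ∀ K s t → K + (K + 1 + s + 1) + t ≡ K + 1 + s + (K + 1 + t)
  e2 = solve-∀
  e3 : ∀ x x′ a b → x + a + (x′ + b) ≡ x + x′ + (a + b)
  e3 = solve-∀
  e4 : ∀ p z a b → p + z + (a + b) ≡ p + a + b + 0 + z
  e4 = solve-∀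

above-noCarry-core : ∀ K s t x x′ z → x ≤ z → x′ ≤ z →
  (K ∸ z) + (q⁺ (K + 1 + s) x ⊓ q⁺ (K + 1 + t) x′) + 1 ≤ (x ⊓ x′) + s * t + (K + 1 + s ∸ x) + (K + 1 + t ∸ x′) + 𝟙 (K <ᵇ z)
above-noCarry-core K s t x x′ z x≤z x′≤z with K <? z
... | yes K<z rewrite m≤n⇒m∸n≡0 (<⇒≤ K<z) | <⇒<ᵇ≡true K<z = begin
    (q⁺ (K + 1 + s) x ⊓ q⁺ (K + 1 + t) x′) + 1 ≤⟨ +-monoˡ-≤ 1 (q⁺⊓q⁺≤ (K + 1 + s) (K + 1 + t) x x′) ⟩
    (x ⊓ x′) + (K + 1 + s ∸ x) + (K + 1 + t ∸ x′) + 1 ≤⟨ +-monoˡ-≤ 1 (+-monoˡ-≤ (K + 1 + t ∸ x′) (+-monoˡ-≤ (K + 1 + s ∸ x) (m≤m+n (x ⊓ x′) (s * t)))) ⟩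
    (x ⊓ x′) + s * t + (K + 1 + s ∸ x) + (K + 1 + t ∸ x′) + 1 ∎
  where open ≤-Reasoning
... | no K≮z = above-noCarry-core-≤ K s t x x′ z x≤z x′≤z (≮⇒≥ K≮z)

above-carry-core : ∀ K s t x x′ z → z ≤ x → z ≤ x′ →
  (K ∸ z) + z + (q⁺ (K + s) x ⊓ q⁺ (K + t) x′) ≤ (x ⊓ x′) + s * t + (K + s ∸ x) + (K + t ∸ x′) + K + 𝟙 (K <ᵇ z)
above-carry-core K s t x x′ z z≤x z≤x′ with K <? z
... | no K≮z rewrite m∸n+n≡m (≮⇒≥ K≮z) | ≥⇒<ᵇ≡false (≮⇒≥ K≮z) = begin
    K + (q⁺ (K + s) x ⊓ q⁺ (K + t) x′) ≤⟨ +-monoʳ-≤ K (q⁺⊓q⁺≤ (K + s) (K + t) x x′) ⟩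
    K + ((x ⊓ x′) + (K + s ∸ x) + (K + t ∸ x′)) ≤⟨ +-monoʳ-≤ K (+-monoˡ-≤ (K + t ∸ x′) (+-monoˡ-≤ (K + s ∸ x) (m≤m+n (x ⊓ x′) (s * t)))) ⟩
    K + ((x ⊓ x′) + s * t + (K + s ∸ x) + (K + t ∸ x′)) ≡⟨ reorder K ((x ⊓ x′) + s * t + (K + s ∸ x) + (K + t ∸ x′)) ⟩
    (x ⊓ x′) + s * t + (K + s ∸ x) + (K + t ∸ x′) + K + 0 ∎
  where
  open ≤-Reasoning
  reorder : ∀ K p → K + p ≡ p + K + 0
  reorder = solve-∀
... | yes K<z rewrite m≤n⇒m∸n≡0 (<⇒≤ K<z) | <⇒<ᵇ≡true K<z = begin
    z + (q⁺ (K + s) x ⊓ q⁺ (K + t) x′) ≤⟨ +-mono-≤ (⊓-glb z≤x z≤x′) (⊓-mono-≤ (q⁺≤1+k (K + s) x) (q⁺≤1+k (K + t) x′)) ⟩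
    (x ⊓ x′) + suc ((K + s) ⊓ (K + t)) ≡⟨ cong (λ w → (x ⊓ x′) + suc w) (sym (+-distribˡ-⊓ K s t)) ⟩
    (x ⊓ x′) + suc (K + (s ⊓ t)) ≤⟨ +-monoʳ-≤ (x ⊓ x′) (s≤s (+-monoʳ-≤ K (⊓≤* s t))) ⟩
    (x ⊓ x′) + suc (K + s * t) ≤⟨ m≤m+n _ ((K + s ∸ x) + (K + t ∸ x′)) ⟩
    (x ⊓ x′) + suc (K + s * t) + ((K + s ∸ x) + (K + t ∸ x′)) ≡⟨ reorder K (s * t) (x ⊓ x′) (K + s ∸ x) (K + t ∸ x′) ⟩
    (x ⊓ x′) + s * t + (K + s ∸ x) + (K + t ∸ x′) + K + 1 ∎
  where
  open ≤-Reasoning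
  reorder : ∀ K q p a b → p + suc (K + q) + (a + b) ≡ p + q + a + b + K + 1
  reorder = solve-∀

ΔΦ : ℕ → ℕ → ℕ → ℕ
ΔΦ m k x = k * (m ∸ suc k) + 2 * (k ∸ x)

below-noCarry-digits : ∀ m k k′ x x′ z → suc (k + k′) ≤ m → x ≤ z → x′ ≤ z →
  ΔΦ m (k + k′) z + 2 * (q⁺ k x ⊓ q⁺ k′ x′) ≤ 2 * (x ⊓ x′) + (ΔΦ m k x + ΔΦ m k′ x′)
-- Matching on m+[n∸m]≡n replaces m by suc (k + k′) + p, where p = m ∸ suc (k + k′).
below-noCarry-digits m k k′ x x′ z k+k′<m x≤z x′≤z with m ∸ suc (k + k′) | m+[n∸m]≡n k+k′<m
... | p | refl = begin
  (k + k′) * p + 2 * A + 2 * U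
    ≡⟨ collect (k + k′) p A U ⟩
  (k + k′) * p + 2 * (A + U)
    ≤⟨ +-monoʳ-≤ ((k + k′) * p) (*-monoʳ-≤ 2 (below-noCarry-core k k′ x x′ z x≤z x′≤z)) ⟩
  (k + k′) * p + 2 * ((x ⊓ x′) + k * k′ + (k ∸ x) + (k′ ∸ x′))
    ≡⟨ expand k k′ p (x ⊓ x′) (k ∸ x) (k′ ∸ x′) ⟩
  2 * (x ⊓ x′) + (k * (k′ + p) + 2 * (k ∸ x) + (k′ * (k + p) + 2 * (k′ ∸ x′)))
    ≡⟨ sym (cong₂ (λ u v → 2 * (x ⊓ x′) + (k * u + 2 * (k ∸ x) + (k′ * v + 2 * (k′ ∸ x′)))) m′∸1+k m′∸1+k′) ⟩
  2 * (x ⊓ x′) + (ΔΦ m′ k x + ΔΦ m′ k′ x′) ∎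
  where
  open ≤-Reasoning
  m′ = suc (k + k′) + p
  A = k + k′ ∸ z
  U = q⁺ k x ⊓ q⁺ k′ x′
  m′∸1+k : m′ ∸ suc k ≡ k′ + p
  m′∸1+k = trans (cong (_∸ k) (+-assoc k k′ p)) (m+n∸m≡n k (k′ + p))
  m′∸1+k′ : m′ ∸ suc k′ ≡ k + p
  m′∸1+k′ = trans (cong (λ w → w + p ∸ k′) (+-comm k k′)) (trans (cong (_∸ k′) (+-assoc k′ k p)) (m+n∸m≡n k′ (k + p)))
  collect : ∀ K p A U → K * p + 2 * A + 2 * U ≡ K * p + 2 * (A + U)
  collect = solve-∀
  expand : ∀ k k′ p w a b → (k + k′) * p + 2 * (w + k * k′ + a + b) ≡ 2 * w + (k * (k′ + p) + 2 * a + (k′ * (k + p) + 2 * b))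
  expand = solve-∀

below-carry-digits : ∀ m k k′ x x′ z → suc (suc (k + k′)) ≤ m → z ≤ x → z ≤ x′ →
  ΔΦ m (suc (k + k′)) z + 2 * (q⁺ k x ⊓ q⁺ k′ x′) + 2 * z ≤ m + 2 * (x ⊓ x′) + (ΔΦ m k x + ΔΦ m k′ x′)
below-carry-digits m k k′ x x′ z k+k′+1<m z≤x z≤x′ with m ∸ suc (suc (k + k′)) | m+[n∸m]≡n k+k′+1<m
... | p | refl = begin
  suc (k + k′) * p + 2 * A + 2 * U + 2 * z
    ≡⟨ collect (suc (k + k′)) p A U z ⟩
  suc (k + k′) * p + 2 * (A + z + U)
    ≤⟨ +-monoʳ-≤ (suc (k + k′) * p) (*-monoʳ-≤ 2 (below-carry-core k k′ x x′ z z≤x z≤x′)) ⟩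
  suc (k + k′) * p + 2 * ((x ⊓ x′) + k * k′ + k + k′ + 1 + (k ∸ x) + (k′ ∸ x′))
    ≡⟨ expand k k′ p (x ⊓ x′) (k ∸ x) (k′ ∸ x′) ⟩
  m′ + 2 * (x ⊓ x′) + (k * (suc k′ + p) + 2 * (k ∸ x) + (k′ * (suc k + p) + 2 * (k′ ∸ x′)))
    ≡⟨ sym (cong₂ (λ u v → m′ + 2 * (x ⊓ x′) + (k * u + 2 * (k ∸ x) + (k′ * v + 2 * (k′ ∸ x′)))) m′∸1+k m′∸1+k′) ⟩
  m′ + 2 * (x ⊓ x′) + (ΔΦ m′ k x + ΔΦ m′ k′ x′) ∎
  where
  open ≤-Reasoning
  m′ = suc (suc (k + k′)) + p
  A = suc (k + k′) ∸ z
  U = q⁺ k x ⊓ q⁺ k′ x′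
  m′∸1+k : m′ ∸ suc k ≡ suc k′ + p
  m′∸1+k = trans (cong (_∸ k) (regroup k k′ p)) (m+n∸m≡n k (suc k′ + p))
    where
    regroup : ∀ k k′ p → suc (k + k′) + p ≡ k + (suc k′ + p)
    regroup = solve-∀
  m′∸1+k′ : m′ ∸ suc k′ ≡ suc k + p
  m′∸1+k′ = trans (cong (_∸ k′) (regroup k k′ p)) (m+n∸m≡n k′ (suc k + p))
    where
    regroup : ∀ k k′ p → suc (k + k′) + p ≡ k′ + (suc k + p)
    regroup = solve-∀
  collect : ∀ K p A U z → K * p + 2 * A + 2 * U + 2 * z ≡ K * p + 2 * (A + z + U)
  collect = solve-∀
  expand : ∀ k k′ p w a b → suc (k + k′) * p + 2 * (w + k * k′ + k + k′ + 1 + a + b)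
                          ≡ suc (suc (k + k′) + p) + 2 * w + (k * (suc k′ + p) + 2 * a + (k′ * (suc k + p) + 2 * b))
  expand = solve-∀

above-noCarry-shape : ∀ m k k′ K → k < m → k′ < m → k + k′ ≡ m + K →
  ∃ λ s → ∃ λ t → k ≡ K + 1 + s × k′ ≡ K + 1 + t × m ≡ suc (K + 1 + s + t)
above-noCarry-shape m k k′ K k<m k′<m k+k′≡m+K = k ∸ (K + 1) , t , sym k≡ , k′≡ , trans m≡ (cong (λ w → suc (w + t)) (sym k≡))
  where
  t = m ∸ suc k
  m≡ : m ≡ suc (k + t)
  m≡ = sym (m+[n∸m]≡n k<m)
  k′≡ : k′ ≡ K + 1 + t
  k′≡ = +-cancelˡ-≡ k k′ (K + 1 + t) (trans k+k′≡m+K (trans (cong (_+ K) m≡) (regroup k t K)))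
    where
    regroup : ∀ k t K → suc (k + t) + K ≡ k + (K + 1 + t)
    regroup = solve-∀
  k≡ : K + 1 + (k ∸ (K + 1)) ≡ k
  k≡ = m+[n∸m]≡n (+-cancelʳ-≤ t (K + 1) k (≤-pred (subst₂ _<_ k′≡ m≡ k′<m)))

above-carry-shape : ∀ m k k′ K → k < m → k′ < m → suc (k + k′) ≡ m + K →
  ∃ λ s → ∃ λ t → k ≡ K + s × k′ ≡ K + t × m ≡ suc (K + s + t)
above-carry-shape m k k′ K k<m k′<m k+k′+1≡m+K = k ∸ K , t , sym k≡ , k′≡ , trans m≡ (cong (λ w → suc (w + t)) (sym k≡))
  where
  t = m ∸ suc k
  m≡ : m ≡ suc (k + t)
  m≡ = sym (m+[n∸m]≡n k<m)
  k′≡ : k′ ≡ K + t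
  k′≡ = +-cancelˡ-≡ k k′ (K + t) (suc-injective (trans k+k′+1≡m+K (trans (cong (_+ K) m≡) (regroup k t K))))
    where
    regroup : ∀ k t K → suc (k + t) + K ≡ suc (k + (K + t))
    regroup = solve-∀
  k≡ : K + (k ∸ K) ≡ k
  k≡ = m+[n∸m]≡n (+-cancelʳ-≤ t K k (≤-pred (subst₂ _<_ k′≡ m≡ k′<m)))

above-noCarry-digits : ∀ m k k′ K x x′ z → k < m → k′ < m → k + k′ ≡ m + K → x ≤ z → x′ ≤ z →
  ΔΦ m K z + m + 2 * (q⁺ k x ⊓ q⁺ k′ x′) ≤ 2 * (x ⊓ x′) + (ΔΦ m k x + ΔΦ m k′ x′ + 2 * q⁺ K z)
above-noCarry-digits m k k′ K x x′ z k<m k′<m k+k′≡m+K x≤z x′≤z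
  with above-noCarry-shape m k k′ K k<m k′<m k+k′≡m+K
... | s , t , refl , refl , refl = begin
  ΔΦ m K z + m + 2 * U
    ≡⟨ cong (λ w → K * w + 2 * A + m + 2 * U) m∸1+K ⟩
  K * (1 + s + t) + 2 * A + m + 2 * U
    ≡⟨ collect K s t A U ⟩
  2 * (A + U + 1) + (K * (1 + s + t) + K + s + t)
    ≤⟨ +-monoˡ-≤ _ (*-monoʳ-≤ 2 (above-noCarry-core K s t x x′ z x≤z x′≤z)) ⟩
  2 * ((x ⊓ x′) + s * t + (k ∸ x) + (k′ ∸ x′) + 𝟙 (K <ᵇ z)) + (K * (1 + s + t) + K + s + t)
    ≡⟨ expand K s t (x ⊓ x′) (k ∸ x) (k′ ∸ x′) (𝟙 (K <ᵇ z)) ⟩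
  2 * (x ⊓ x′) + (k * t + 2 * (k ∸ x) + (k′ * s + 2 * (k′ ∸ x′)) + 2 * q⁺ K z)
    ≡⟨ sym (cong₂ (λ u v → 2 * (x ⊓ x′) + (k * u + 2 * (k ∸ x) + (k′ * v + 2 * (k′ ∸ x′)) + 2 * q⁺ K z)) m∸1+k m∸1+k′) ⟩
  2 * (x ⊓ x′) + (ΔΦ m k x + ΔΦ m k′ x′ + 2 * q⁺ K z) ∎
  where
  open ≤-Reasoning
  A = K ∸ z
  U = q⁺ k x ⊓ q⁺ k′ x′
  m∸1+K : K + 1 + s + t ∸ K ≡ 1 + s + t
  m∸1+K = trans (cong (_∸ K) (+-assoc (K + 1) s t ⟨ trans ⟩ +-assoc K 1 (s + t))) (m+n∸m≡n K (1 + s + t))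
  m∸1+k : K + 1 + s + t ∸ k ≡ t
  m∸1+k = m+n∸m≡n k t
  m∸1+k′ : K + 1 + s + t ∸ k′ ≡ s
  m∸1+k′ = trans (cong (_∸ k′) (+-assoc (K + 1) s t ⟨ trans ⟩ cong (K + 1 +_) (+-comm s t) ⟨ trans ⟩ sym (+-assoc (K + 1) t s)))
                 (m+n∸m≡n k′ s)
  collect : ∀ K s t A U → K * (1 + s + t) + 2 * A + suc (K + 1 + s + t) + 2 * U ≡ 2 * (A + U + 1) + (K * (1 + s + t) + K + s + t)
  collect = solve-∀
  expand : ∀ K s t w a b i → 2 * (w + s * t + a + b + i) + (K * (1 + s + t) + K + s + t)
                           ≡ 2 * w + ((K + 1 + s) * t + 2 * a + ((K + 1 + t) * s + 2 * b) + 2 * (K + i))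
  expand = solve-∀

above-carry-digits : ∀ m k k′ K x x′ z → k < m → k′ < m → suc (k + k′) ≡ m + K → z ≤ x → z ≤ x′ →
  ΔΦ m K z + m + 2 * (q⁺ k x ⊓ q⁺ k′ x′) + 2 * z ≤ m + 2 * (x ⊓ x′) + (ΔΦ m k x + ΔΦ m k′ x′ + 2 * q⁺ K z)
above-carry-digits m k k′ K x x′ z k<m k′<m k+k′+1≡m+K z≤x z≤x′
  with above-carry-shape m k k′ K k<m k′<m k+k′+1≡m+K
... | s , t , refl , refl , refl = begin
  ΔΦ m K z + m + 2 * U + 2 * z
    ≡⟨ cong (λ w → K * w + 2 * A + m + 2 * U + 2 * z) m∸1+K ⟩
  K * (s + t) + 2 * A + m + 2 * U + 2 * z
    ≡⟨ collect K s t A U z ⟩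
  2 * (A + z + U) + (K * (s + t) + m)
    ≤⟨ +-monoˡ-≤ _ (*-monoʳ-≤ 2 (above-carry-core K s t x x′ z z≤x z≤x′)) ⟩
  2 * ((x ⊓ x′) + s * t + (k ∸ x) + (k′ ∸ x′) + K + 𝟙 (K <ᵇ z)) + (K * (s + t) + m)
    ≡⟨ expand K s t (x ⊓ x′) (k ∸ x) (k′ ∸ x′) (𝟙 (K <ᵇ z)) ⟩
  m + 2 * (x ⊓ x′) + (k * t + 2 * (k ∸ x) + (k′ * s + 2 * (k′ ∸ x′)) + 2 * q⁺ K z)
    ≡⟨ sym (cong₂ (λ u v → m + 2 * (x ⊓ x′) + (k * u + 2 * (k ∸ x) + (k′ * v + 2 * (k′ ∸ x′)) + 2 * q⁺ K z)) m∸1+k m∸1+k′) ⟩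
  m + 2 * (x ⊓ x′) + (ΔΦ m k x + ΔΦ m k′ x′ + 2 * q⁺ K z) ∎
  where
  open ≤-Reasoning
  A = K ∸ z
  U = q⁺ k x ⊓ q⁺ k′ x′
  m∸1+K : K + s + t ∸ K ≡ s + t
  m∸1+K = trans (cong (_∸ K) (+-assoc K s t)) (m+n∸m≡n K (s + t))
  m∸1+k : K + s + t ∸ k ≡ t
  m∸1+k = m+n∸m≡n k t
  m∸1+k′ : K + s + t ∸ k′ ≡ s
  m∸1+k′ = trans (cong (_∸ k′) (+-assoc K s t ⟨ trans ⟩ cong (K +_) (+-comm s t) ⟨ trans ⟩ sym (+-assoc K t s))) (m+n∸m≡n k′ s)
  collect : ∀ K s t A U z → K * (s + t) + 2 * A + suc (K + s + t) + 2 * U + 2 * z ≡ 2 * (A + z + U) + (K * (s + t) + suc (K + s + t))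
  collect = solve-∀
  expand : ∀ K s t w a b i → 2 * (w + s * t + a + b + K + i) + (K * (s + t) + suc (K + s + t))
                           ≡ suc (K + s + t) + 2 * w + ((K + s) * t + 2 * a + ((K + t) * s + 2 * b) + 2 * (K + i))
  expand = solve-∀

∸-pair+q⁺≡ : ∀ k x → (k ∸ x) + (x ∸ suc k) + q⁺ k x ≡ x + 2 * (k ∸ x)
∸-pair+q⁺≡ k x with <-cmp k x
... | tri< k<x _ _ rewrite m≤n⇒m∸n≡0 (<⇒≤ k<x) | <⇒<ᵇ≡true k<x =
  trans (cong ((x ∸ suc k) +_) (+-comm k 1)) (trans (m∸n+n≡m k<x) (sym (+-identityʳ x)))
... | tri≈ _ refl _ rewrite n∸n≡0 k | ≥⇒<ᵇ≡false {k} ≤-refl | m≤n⇒m∸n≡0 (n≤1+n k) = refl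
... | tri> _ _ x<k rewrite m≤n⇒m∸n≡0 (m≤n⇒m≤1+n (<⇒≤ x<k)) | ≥⇒<ᵇ≡false (<⇒≤ x<k) = begin
  k ∸ x + 0 + (k + 0)      ≡⟨ cong₂ _+_ (+-identityʳ (k ∸ x)) (trans (+-identityʳ k) (sym (m+[n∸m]≡n (<⇒≤ x<k)))) ⟩
  (k ∸ x) + (x + (k ∸ x))  ≡⟨ reorder (k ∸ x) x ⟩
  x + 2 * (k ∸ x)          ∎
  where
  open ≡-Reasoning
  reorder : ∀ a x → a + (x + a) ≡ x + 2 * a
  reorder = solve-∀

≤-combine : ∀ P W R V X Y → P + W ≤ R + V → X + V ≤ W + Y → P + X ≤ R + Y
≤-combine P W R V X Y P+W≤R+V X+V≤W+Y = +-cancelʳ-≤ (W + V) (P + X) (R + Y) (begin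
  P + X + (W + V)    ≡⟨ regroup P X W V ⟩
  (P + W) + (X + V)  ≤⟨ +-mono-≤ P+W≤R+V X+V≤W+Y ⟩
  (R + V) + (W + Y)  ≡⟨ regroup′ R V W Y ⟩
  R + Y + (W + V)    ∎)
  where
  open ≤-Reasoning
  regroup : ∀ P X W V → P + X + (W + V) ≡ (P + W) + (X + V)
  regroup = solve-∀
  regroup′ : ∀ R V W Y → (R + V) + (W + Y) ≡ R + Y + (W + V)
  regroup′ = solve-∀

≤-combine₀ : ∀ P W R X Y → P + W ≤ R → X ≤ W + Y → P + X ≤ R + Y
≤-combine₀ P W R X Y P+W≤R X≤W+Y =
  ≤-combine P W R 0 X Y (subst (P + W ≤_) (sym (+-identityʳ R)) P+W≤R) (subst (_≤ W + Y) (sym (+-identityʳ X)) X≤W+Y)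

-- Induction on n

module _ (m : ℕ) where

  Φ : ℕ → ℕ → ℕ
  Φ n ℓ = thetaLex n m ℓ + q n m ℓ

  Φ-suc : ∀ n k r → k < m → r ≤ m ^ n → Φ (suc n) (k * m ^ n + r) ≡ Φ n r + ΔΦ m k (q n m r)
  Φ-suc n k r k<m r≤M = begin
    Φ (suc n) (k * m ^ n + r)
      ≡⟨ cong₂ _+_ (thetaLex-suc m n k r k<m r≤M) (q-suc m n k r k<m r≤M) ⟩
    θ + (B + (k ∸ x) + (x ∸ suc k)) + q⁺ k x
      ≡⟨ regroup θ B (k ∸ x) (x ∸ suc k) (q⁺ k x) ⟩
    θ + B + ((k ∸ x) + (x ∸ suc k) + q⁺ k x)
      ≡⟨ cong (θ + B +_) (∸-pair+q⁺≡ k x) ⟩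
    θ + B + (x + 2 * (k ∸ x))
      ≡⟨ regroup′ θ B x (k ∸ x) ⟩
    Φ n r + ΔΦ m k x ∎
    where
    open ≡-Reasoning
    x = q n m r
    θ = thetaLex n m r
    B = k * (m ∸ suc k)
    regroup : ∀ θ B a b c → θ + (B + a + b) + c ≡ θ + B + (a + b + c)
    regroup = solve-∀
    regroup′ : ∀ θ B x a → θ + B + (x + 2 * a) ≡ θ + x + (B + 2 * a)
    regroup′ = solve-∀

  q-zero : ∀ n → q n m 0 ≡ 0
  q-zero n = trans (q≡∑<-cornerIn m n 0) (∑<-zero m _ (λ _ _ → refl))

  thetaLex-zero : ∀ n → thetaLex n m 0 ≡ 0
  thetaLex-zero n = trans (thetaLex≡boundary n m 0) (boundary-empty m n)

  q-full : ∀ n → q n m (m ^ n) ≡ m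
  q-full n = trans (q≡∑<-cornerIn m n (m ^ n)) (∑<-𝟙-all m (cornerIn m n (m ^ n)) (λ j j<m → ≤⇒≤ᵇ≡true (corner<m^n m n j j<m)))

  thetaLex-full : ∀ n → thetaLex n m (m ^ n) ≡ 0
  thetaLex-full n = trans (thetaLex≡boundary n m (m ^ n)) (boundary-full m n (m ^ n) ≤-refl)

  Φ-full : ∀ n → Φ n (m ^ n) ≡ m
  Φ-full n = cong₂ _+_ (thetaLex-full n) (q-full n)

  SumBelow : ℕ → Set
  SumBelow n = ∀ a b → a + b ≤ m ^ n → Φ n (a + b) + 2 * (q n m a ⊓ q n m b) ≤ Φ n a + Φ n b

  SumAbove : ℕ → Set
  SumAbove n = ∀ a b c → a ≤ m ^ n → b ≤ m ^ n → a + b ≡ m ^ n + c →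
               Φ n c + m + 2 * (q n m a ⊓ q n m b) ≤ Φ n a + Φ n b + 2 * q n m c

  private
    digitwise-+ : ∀ k r k′ r′ M → (k * M + r) + (k′ * M + r′) ≡ (k + k′) * M + (r + r′)
    digitwise-+ = solve-∀

    interchange : ∀ a b c d → (a + b) + (c + d) ≡ (a + c) + (b + d)
    interchange = solve-∀

    carry-split : ∀ M r r′ → M < r + r′ → r + r′ ≡ M + (r + r′ ∸ M)
    carry-split M r r′ M<r+r′ = sym (m+[n∸m]≡n (<⇒≤ M<r+r′))

    carry≤ : ∀ M r r′ → r′ ≤ M → r + r′ ∸ M ≤ r
    carry≤ M r r′ r′≤M = ≤-trans (∸-monoˡ-≤ M (+-monoʳ-≤ r r′≤M)) (≤-reflexive (m+n∸n≡m r M))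

    carry≤′ : ∀ M r r′ → r ≤ M → r + r′ ∸ M ≤ r′
    carry≤′ M r r′ r≤M = subst (_≤ r′) (cong (_∸ M) (+-comm r′ r)) (carry≤ M r′ r r≤M)

    reassoc : ∀ a b c d → a + b + c + d ≡ a + (b + c + d)
    reassoc = solve-∀

    interchange₃ : ∀ a b c d e → (a + b) + (c + d + e) ≡ (a + c) + (b + d) + e
    interchange₃ = solve-∀

    digitwise-+-carry : ∀ k r k′ r′ M → M < r + r′ → (k * M + r) + (k′ * M + r′) ≡ suc (k + k′) * M + (r + r′ ∸ M)
    digitwise-+-carry k r k′ r′ M M<r+r′ =
      trans (digitwise-+ k r k′ r′ M) (trans (cong ((k + k′) * M +_) (carry-split M r r′ M<r+r′)) (absorb (k + k′) M _))
      where
      absorb : ∀ K M s → K * M + (M + s) ≡ suc K * M + s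
      absorb = solve-∀

    split-leading : ∀ m K M t → (m + K) * M + t ≡ m * M + (K * M + t)
    split-leading = solve-∀

  below-noCarry-step : ∀ n → SumBelow n → ∀ k r k′ r′ → k + k′ < m → r ≤ m ^ n → r′ ≤ m ^ n → r + r′ ≤ m ^ n →
    Φ (suc n) ((k * m ^ n + r) + (k′ * m ^ n + r′)) + 2 * (q (suc n) m (k * m ^ n + r) ⊓ q (suc n) m (k′ * m ^ n + r′))
      ≤ Φ (suc n) (k * m ^ n + r) + Φ (suc n) (k′ * m ^ n + r′)
  below-noCarry-step n below k r k′ r′ k+k′<m r≤M r′≤M r+r′≤M = begin
    Φ (suc n) ((k * M + r) + (k′ * M + r′)) + 2 * (q (suc n) m (k * M + r) ⊓ q (suc n) m (k′ * M + r′))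
      ≡⟨ cong₂ (λ u v → u + 2 * v) (trans (cong (Φ (suc n)) (digitwise-+ k r k′ r′ M)) (Φ-suc n (k + k′) (r + r′) k+k′<m r+r′≤M))
                                   (cong₂ _⊓_ (q-suc m n k r k<m r≤M) (q-suc m n k′ r′ k′<m r′≤M)) ⟩
    Φ n (r + r′) + ΔΦ m (k + k′) z + 2 * (q⁺ k x ⊓ q⁺ k′ x′)
      ≡⟨ +-assoc (Φ n (r + r′)) _ _ ⟩
    Φ n (r + r′) + (ΔΦ m (k + k′) z + 2 * (q⁺ k x ⊓ q⁺ k′ x′))
      ≤⟨ ≤-combine₀ (Φ n (r + r′)) (2 * (x ⊓ x′)) (Φ n r + Φ n r′) _ (ΔΦ m k x + ΔΦ m k′ x′)
           (below r r′ r+r′≤M)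
           (below-noCarry-digits m k k′ x x′ z k+k′<m (q-mono m n (m≤m+n r r′)) (q-mono m n (m≤n+m r′ r))) ⟩
    (Φ n r + Φ n r′) + (ΔΦ m k x + ΔΦ m k′ x′)
      ≡⟨ interchange (Φ n r) (Φ n r′) _ _ ⟩
    (Φ n r + ΔΦ m k x) + (Φ n r′ + ΔΦ m k′ x′)
      ≡⟨ sym (cong₂ _+_ (Φ-suc n k r k<m r≤M) (Φ-suc n k′ r′ k′<m r′≤M)) ⟩
    Φ (suc n) (k * M + r) + Φ (suc n) (k′ * M + r′) ∎
    where
    open ≤-Reasoning
    M = m ^ n
    x = q n m r
    x′ = q n m r′
    z = q n m (r + r′)
    k<m : k < m
    k<m = ≤-<-trans (m≤m+n k k′) k+k′<m
    k′<m : k′ < m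
    k′<m = ≤-<-trans (m≤n+m k′ k) k+k′<m

  below-carry-step : ∀ n → SumAbove n → ∀ k r k′ r′ → suc (k + k′) < m → r ≤ m ^ n → r′ ≤ m ^ n → m ^ n < r + r′ →
    Φ (suc n) ((k * m ^ n + r) + (k′ * m ^ n + r′)) + 2 * (q (suc n) m (k * m ^ n + r) ⊓ q (suc n) m (k′ * m ^ n + r′))
      ≤ Φ (suc n) (k * m ^ n + r) + Φ (suc n) (k′ * m ^ n + r′)
  below-carry-step n above k r k′ r′ k+k′+1<m r≤M r′≤M M<r+r′ = begin
    Φ (suc n) ((k * M + r) + (k′ * M + r′)) + 2 * (q (suc n) m (k * M + r) ⊓ q (suc n) m (k′ * M + r′))
      ≡⟨ cong₂ (λ u v → u + 2 * v) (trans (cong (Φ (suc n)) (digitwise-+-carry k r k′ r′ M M<r+r′)) (Φ-suc n (suc (k + k′)) s k+k′+1<m s≤M))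
                                   (cong₂ _⊓_ (q-suc m n k r k<m r≤M) (q-suc m n k′ r′ k′<m r′≤M)) ⟩
    Φ n s + ΔΦ m (suc (k + k′)) z + 2 * (q⁺ k x ⊓ q⁺ k′ x′)
      ≡⟨ +-assoc (Φ n s) _ _ ⟩
    Φ n s + (ΔΦ m (suc (k + k′)) z + 2 * (q⁺ k x ⊓ q⁺ k′ x′))
      ≤⟨ ≤-combine (Φ n s) (m + 2 * (x ⊓ x′)) (Φ n r + Φ n r′) (2 * z) _ (ΔΦ m k x + ΔΦ m k′ x′)
           (≤-trans (≤-reflexive (sym (+-assoc (Φ n s) m _))) (above r r′ s r≤M r′≤M (carry-split M r r′ M<r+r′)))
           (below-carry-digits m k k′ x x′ z k+k′+1<m (q-mono m n s≤r) (q-mono m n s≤r′)) ⟩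
    (Φ n r + Φ n r′) + (ΔΦ m k x + ΔΦ m k′ x′)
      ≡⟨ interchange (Φ n r) (Φ n r′) _ _ ⟩
    (Φ n r + ΔΦ m k x) + (Φ n r′ + ΔΦ m k′ x′)
      ≡⟨ sym (cong₂ _+_ (Φ-suc n k r k<m r≤M) (Φ-suc n k′ r′ k′<m r′≤M)) ⟩
    Φ (suc n) (k * M + r) + Φ (suc n) (k′ * M + r′) ∎
    where
    open ≤-Reasoning
    M = m ^ n
    s = r + r′ ∸ M
    x = q n m r
    x′ = q n m r′
    z = q n m s
    s≤r : s ≤ r
    s≤r = carry≤ M r r′ r′≤M
    s≤r′ : s ≤ r′
    s≤r′ = carry≤′ M r r′ r≤M
    s≤M : s ≤ M
    s≤M = ≤-trans s≤r r≤M
    k<m : k < m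
    k<m = ≤-<-trans (≤-trans (m≤m+n k k′) (n≤1+n _)) k+k′+1<m
    k′<m : k′ < m
    k′<m = ≤-<-trans (≤-trans (m≤n+m k′ k) (n≤1+n _)) k+k′+1<m

  above-noCarry-leading : ∀ M k r k′ r′ c → k < m → k′ < m → 1 ≤ c → r + r′ ≤ M →
    (k * M + r) + (k′ * M + r′) ≡ m * M + c → ∃ λ K → K < m × k + k′ ≡ m + K × c ≡ K * M + (r + r′)
  above-noCarry-leading M k r k′ r′ c k<m k′<m 1≤c r+r′≤M a+b≡ = K , K<m , k+k′≡m+K , c≡
    where
    m≤k+k′ : m ≤ k + k′
    m≤k+k′ with m ≤? k + k′
    ... | yes m≤k+k′ = m≤k+k′
    ... | no m≰k+k′ = ⊥-elim (<-irrefl refl (begin-strict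
      m * M                        <⟨ m<m+n (m * M) 1≤c ⟩
      m * M + c                    ≡⟨ sym a+b≡ ⟩
      (k * M + r) + (k′ * M + r′)  ≡⟨ digitwise-+ k r k′ r′ M ⟩
      (k + k′) * M + (r + r′)      ≤⟨ +-monoʳ-≤ ((k + k′) * M) r+r′≤M ⟩
      (k + k′) * M + M             ≡⟨ +-comm ((k + k′) * M) M ⟩
      suc (k + k′) * M             ≤⟨ *-monoˡ-≤ M (≰⇒> m≰k+k′) ⟩
      m * M                        ∎))
      where open ≤-Reasoning
    K = k + k′ ∸ m
    k+k′≡m+K : k + k′ ≡ m + K
    k+k′≡m+K = sym (m+[n∸m]≡n m≤k+k′)
    c≡ : c ≡ K * M + (r + r′)
    c≡ = +-cancelˡ-≡ (m * M) c (K * M + (r + r′))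
           (trans (sym a+b≡) (trans (digitwise-+ k r k′ r′ M) (trans (cong (λ w → w * M + (r + r′)) k+k′≡m+K) (split-leading m K M (r + r′)))))
    K<m : K < m
    K<m = <-trans (+-cancelˡ-< m K k (begin-strict
      m + K   ≡⟨ sym k+k′≡m+K ⟩
      k + k′  <⟨ +-monoʳ-< k k′<m ⟩
      k + m   ≡⟨ +-comm k m ⟩
      m + k   ∎)) k<m
      where open ≤-Reasoning

  above-carry-leading : ∀ M k r k′ r′ c → k < m → k′ < m → 1 ≤ c → r ≤ M → r′ ≤ M → M < r + r′ →
    (k * M + r) + (k′ * M + r′) ≡ m * M + c → ∃ λ K → K < m × suc (k + k′) ≡ m + K × c ≡ K * M + (r + r′ ∸ M)
  above-carry-leading M k r k′ r′ c k<m k′<m 1≤c r≤M r′≤M M<r+r′ a+b≡ = K , K<m , k+k′+1≡m+K , c≡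
    where
    s = r + r′ ∸ M
    a+b≡′ : (k * M + r) + (k′ * M + r′) ≡ suc (k + k′) * M + s
    a+b≡′ = digitwise-+-carry k r k′ r′ M M<r+r′
    m≤k+k′+1 : m ≤ suc (k + k′)
    m≤k+k′+1 with m ≤? suc (k + k′)
    ... | yes m≤k+k′+1 = m≤k+k′+1
    ... | no m≰k+k′+1 = ⊥-elim (<-irrefl refl (begin-strict
      m * M                        <⟨ m<m+n (m * M) 1≤c ⟩
      m * M + c                    ≡⟨ sym a+b≡ ⟩
      (k * M + r) + (k′ * M + r′)  ≡⟨ a+b≡′ ⟩
      suc (k + k′) * M + s         ≤⟨ +-monoʳ-≤ (suc (k + k′) * M) (≤-trans (carry≤ M r r′ r′≤M) r≤M) ⟩
      suc (k + k′) * M + M         ≡⟨ +-comm (suc (k + k′) * M) M ⟩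
      suc (suc (k + k′)) * M       ≤⟨ *-monoˡ-≤ M (≰⇒> m≰k+k′+1) ⟩
      m * M                        ∎))
      where open ≤-Reasoning
    K = suc (k + k′) ∸ m
    k+k′+1≡m+K : suc (k + k′) ≡ m + K
    k+k′+1≡m+K = sym (m+[n∸m]≡n m≤k+k′+1)
    c≡ : c ≡ K * M + s
    c≡ = +-cancelˡ-≡ (m * M) c (K * M + s)
           (trans (sym a+b≡) (trans a+b≡′ (trans (cong (λ w → w * M + s) k+k′+1≡m+K) (split-leading m K M s))))
    K<m : K < m
    K<m = ≤-<-trans (+-cancelˡ-≤ m K k (begin
      m + K         ≡⟨ sym k+k′+1≡m+K ⟩
      suc (k + k′)  ≡⟨ sym (+-suc k k′) ⟩
      k + suc k′    ≤⟨ +-monoʳ-≤ k k′<m ⟩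
      k + m         ≡⟨ +-comm k m ⟩
      m + k         ∎)) k<m
      where open ≤-Reasoning

  above-noCarry-step : ∀ n → SumBelow n → ∀ k r k′ r′ K → k < m → r ≤ m ^ n → k′ < m → r′ ≤ m ^ n → K < m →
    k + k′ ≡ m + K → r + r′ ≤ m ^ n →
    Φ (suc n) (K * m ^ n + (r + r′)) + m + 2 * (q (suc n) m (k * m ^ n + r) ⊓ q (suc n) m (k′ * m ^ n + r′))
      ≤ Φ (suc n) (k * m ^ n + r) + Φ (suc n) (k′ * m ^ n + r′) + 2 * q (suc n) m (K * m ^ n + (r + r′))
  above-noCarry-step n below k r k′ r′ K k<m r≤M k′<m r′≤M K<m k+k′≡m+K r+r′≤M = begin
    Φ (suc n) (K * M + (r + r′)) + m + 2 * (q (suc n) m (k * M + r) ⊓ q (suc n) m (k′ * M + r′))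
      ≡⟨ cong₂ (λ u v → u + m + 2 * v) (Φ-suc n K (r + r′) K<m r+r′≤M)
                                       (cong₂ _⊓_ (q-suc m n k r k<m r≤M) (q-suc m n k′ r′ k′<m r′≤M)) ⟩
    Φ n (r + r′) + ΔΦ m K z + m + 2 * (q⁺ k x ⊓ q⁺ k′ x′)
      ≡⟨ reassoc (Φ n (r + r′)) (ΔΦ m K z) m _ ⟩
    Φ n (r + r′) + (ΔΦ m K z + m + 2 * (q⁺ k x ⊓ q⁺ k′ x′))
      ≤⟨ ≤-combine₀ (Φ n (r + r′)) (2 * (x ⊓ x′)) (Φ n r + Φ n r′) _ (ΔΦ m k x + ΔΦ m k′ x′ + 2 * q⁺ K z)
           (below r r′ r+r′≤M)
           (above-noCarry-digits m k k′ K x x′ z k<m k′<m k+k′≡m+K (q-mono m n (m≤m+n r r′)) (q-mono m n (m≤n+m r′ r))) ⟩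
    (Φ n r + Φ n r′) + (ΔΦ m k x + ΔΦ m k′ x′ + 2 * q⁺ K z)
      ≡⟨ interchange₃ (Φ n r) (Φ n r′) (ΔΦ m k x) (ΔΦ m k′ x′) (2 * q⁺ K z) ⟩
    (Φ n r + ΔΦ m k x) + (Φ n r′ + ΔΦ m k′ x′) + 2 * q⁺ K z
      ≡⟨ sym (cong₂ (λ u v → u + 2 * v) (cong₂ _+_ (Φ-suc n k r k<m r≤M) (Φ-suc n k′ r′ k′<m r′≤M))
                                       (q-suc m n K (r + r′) K<m r+r′≤M)) ⟩
    Φ (suc n) (k * M + r) + Φ (suc n) (k′ * M + r′) + 2 * q (suc n) m (K * M + (r + r′)) ∎
    where
    open ≤-Reasoning
    M = m ^ n
    x = q n m r
    x′ = q n m r′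
    z = q n m (r + r′)

  above-carry-step : ∀ n → SumAbove n → ∀ k r k′ r′ K → k < m → r ≤ m ^ n → k′ < m → r′ ≤ m ^ n → K < m →
    suc (k + k′) ≡ m + K → m ^ n < r + r′ →
    Φ (suc n) (K * m ^ n + (r + r′ ∸ m ^ n)) + m + 2 * (q (suc n) m (k * m ^ n + r) ⊓ q (suc n) m (k′ * m ^ n + r′))
      ≤ Φ (suc n) (k * m ^ n + r) + Φ (suc n) (k′ * m ^ n + r′) + 2 * q (suc n) m (K * m ^ n + (r + r′ ∸ m ^ n))
  above-carry-step n above k r k′ r′ K k<m r≤M k′<m r′≤M K<m k+k′+1≡m+K M<r+r′ = begin
    Φ (suc n) (K * M + s) + m + 2 * (q (suc n) m (k * M + r) ⊓ q (suc n) m (k′ * M + r′))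
      ≡⟨ cong₂ (λ u v → u + m + 2 * v) (Φ-suc n K s K<m s≤M)
                                       (cong₂ _⊓_ (q-suc m n k r k<m r≤M) (q-suc m n k′ r′ k′<m r′≤M)) ⟩
    Φ n s + ΔΦ m K z + m + 2 * (q⁺ k x ⊓ q⁺ k′ x′)
      ≡⟨ reassoc (Φ n s) (ΔΦ m K z) m _ ⟩
    Φ n s + (ΔΦ m K z + m + 2 * (q⁺ k x ⊓ q⁺ k′ x′))
      ≤⟨ ≤-combine (Φ n s) (m + 2 * (x ⊓ x′)) (Φ n r + Φ n r′) (2 * z) _ (ΔΦ m k x + ΔΦ m k′ x′ + 2 * q⁺ K z)
           (≤-trans (≤-reflexive (sym (+-assoc (Φ n s) m _))) (above r r′ s r≤M r′≤M (carry-split M r r′ M<r+r′)))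
           (above-carry-digits m k k′ K x x′ z k<m k′<m k+k′+1≡m+K (q-mono m n s≤r) (q-mono m n s≤r′)) ⟩
    (Φ n r + Φ n r′) + (ΔΦ m k x + ΔΦ m k′ x′ + 2 * q⁺ K z)
      ≡⟨ interchange₃ (Φ n r) (Φ n r′) (ΔΦ m k x) (ΔΦ m k′ x′) (2 * q⁺ K z) ⟩
    (Φ n r + ΔΦ m k x) + (Φ n r′ + ΔΦ m k′ x′) + 2 * q⁺ K z
      ≡⟨ sym (cong₂ (λ u v → u + 2 * v) (cong₂ _+_ (Φ-suc n k r k<m r≤M) (Φ-suc n k′ r′ k′<m r′≤M))
                                       (q-suc m n K s K<m s≤M)) ⟩
    Φ (suc n) (k * M + r) + Φ (suc n) (k′ * M + r′) + 2 * q (suc n) m (K * M + s) ∎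
    where
    open ≤-Reasoning
    M = m ^ n
    s = r + r′ ∸ M
    x = q n m r
    x′ = q n m r′
    z = q n m s
    s≤r : s ≤ r
    s≤r = carry≤ M r r′ r′≤M
    s≤r′ : s ≤ r′
    s≤r′ = carry≤′ M r r′ r≤M
    s≤M : s ≤ M
    s≤M = ≤-trans s≤r r≤M

  leadingDigit : 1 ≤ m → ∀ n ℓ → 1 ≤ ℓ → ℓ ≤ m * m ^ n →
    ∃ λ k → ∃ λ r → k < m × 1 ≤ r × r ≤ m ^ n × ℓ ≡ k * m ^ n + r
  leadingDigit 1≤m n (suc ℓ′) _ ℓ≤mM = ℓ′ / M , suc (ℓ′ % M) , m<n*o⇒m/o<n ℓ≤mM , s≤s z≤n , m%n<n ℓ′ M , split
    where
    M = m ^ n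
    instance
      M≢0 : NonZero M
      M≢0 = m^n≢0 m n {{>-nonZero 1≤m}}
    split : suc ℓ′ ≡ ℓ′ / M * M + suc (ℓ′ % M)
    split = trans (cong suc (trans (m≡m%n+[m/n]*n ℓ′ M) (+-comm (ℓ′ % M) _))) (sym (+-suc _ _))

  leading< : ∀ M K N t → 1 ≤ t → K * M + t ≤ N * M → K < N
  leading< M K N t 1≤t KM+t≤NM = *-cancelʳ-< M K N (<-≤-trans (m<m+n (K * M) 1≤t) KM+t≤NM)

  sumBelow-zeroˡ : ∀ n b → Φ n (0 + b) + 2 * (q n m 0 ⊓ q n m b) ≤ Φ n 0 + Φ n b
  sumBelow-zeroˡ n b rewrite q-zero n | thetaLex-zero n = ≤-reflexive (+-identityʳ (Φ n b))

  sumBelow-zeroʳ : ∀ n a → Φ n (a + 0) + 2 * (q n m a ⊓ q n m 0) ≤ Φ n a + Φ n 0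
  sumBelow-zeroʳ n a rewrite q-zero n | thetaLex-zero n | +-identityʳ a | ⊓-zeroʳ (q n m a) = ≤-refl

  sumAbove-exact : ∀ n → SumBelow n → ∀ a b → a + b ≡ m ^ n + 0 →
    Φ n 0 + m + 2 * (q n m a ⊓ q n m b) ≤ Φ n a + Φ n b + 2 * q n m 0
  sumAbove-exact n below a b a+b≡M rewrite q-zero n | thetaLex-zero n | +-identityʳ (m ^ n) | +-identityʳ (Φ n a + Φ n b) =
    subst (λ w → w + 2 * (q n m a ⊓ q n m b) ≤ Φ n a + Φ n b) (trans (cong (Φ n) a+b≡M) (Φ-full n)) (below a b (≤-reflexive a+b≡M))

  sumBelow-suc-pos : 1 ≤ m → ∀ n → SumBelow n → SumAbove n → ∀ a b → 1 ≤ a → 1 ≤ b → a + b ≤ m * m ^ n →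
    Φ (suc n) (a + b) + 2 * (q (suc n) m a ⊓ q (suc n) m b) ≤ Φ (suc n) a + Φ (suc n) b
  sumBelow-suc-pos 1≤m n below above a b 1≤a 1≤b a+b≤mM
    with leadingDigit 1≤m n a 1≤a (≤-trans (m≤m+n a b) a+b≤mM) | leadingDigit 1≤m n b 1≤b (≤-trans (m≤n+m b a) a+b≤mM)
  ... | k , r , _ , 1≤r , r≤M , refl | k′ , r′ , _ , _ , r′≤M , refl with r + r′ ≤? m ^ n
  ...   | yes r+r′≤M = below-noCarry-step n below k r k′ r′ k+k′<m r≤M r′≤M r+r′≤M
    where
    k+k′<m : k + k′ < m
    k+k′<m = leading< (m ^ n) (k + k′) m (r + r′) (≤-trans 1≤r (m≤m+n r r′))
               (subst (_≤ m * m ^ n) (digitwise-+ k r k′ r′ (m ^ n)) a+b≤mM)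
  ...   | no r+r′≰M = below-carry-step n above k r k′ r′ k+k′+1<m r≤M r′≤M M<r+r′
    where
    M<r+r′ : m ^ n < r + r′
    M<r+r′ = ≰⇒> r+r′≰M
    k+k′+1<m : suc (k + k′) < m
    k+k′+1<m = leading< (m ^ n) (suc (k + k′)) m (r + r′ ∸ m ^ n) (m<n⇒0<n∸m M<r+r′)
                 (subst (_≤ m * m ^ n) (digitwise-+-carry k r k′ r′ (m ^ n) M<r+r′) a+b≤mM)

  sumAbove-suc-pos : 1 ≤ m → ∀ n → SumBelow n → SumAbove n → ∀ a b c → 1 ≤ a → 1 ≤ b → 1 ≤ c →
    a ≤ m * m ^ n → b ≤ m * m ^ n → a + b ≡ m * m ^ n + c →
    Φ (suc n) c + m + 2 * (q (suc n) m a ⊓ q (suc n) m b) ≤ Φ (suc n) a + Φ (suc n) b + 2 * q (suc n) m c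
  sumAbove-suc-pos 1≤m n below above a b c 1≤a 1≤b 1≤c a≤mM b≤mM a+b≡
    with leadingDigit 1≤m n a 1≤a a≤mM | leadingDigit 1≤m n b 1≤b b≤mM
  ... | k , r , k<m , _ , r≤M , refl | k′ , r′ , k′<m , _ , r′≤M , refl with r + r′ ≤? m ^ n
  ...   | yes r+r′≤M with above-noCarry-leading (m ^ n) k r k′ r′ c k<m k′<m 1≤c r+r′≤M a+b≡
  ...     | K , K<m , k+k′≡m+K , refl = above-noCarry-step n below k r k′ r′ K k<m r≤M k′<m r′≤M K<m k+k′≡m+K r+r′≤M
  sumAbove-suc-pos 1≤m n below above a b c 1≤a 1≤b 1≤c a≤mM b≤mM a+b≡
    | k , r , k<m , _ , r≤M , refl | k′ , r′ , k′<m , _ , r′≤M , refl | no r+r′≰M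
    with above-carry-leading (m ^ n) k r k′ r′ c k<m k′<m 1≤c r≤M r′≤M (≰⇒> r+r′≰M) a+b≡
  ... | K , K<m , k+k′+1≡m+K , refl = above-carry-step n above k r k′ r′ K k<m r≤M k′<m r′≤M K<m k+k′+1≡m+K (≰⇒> r+r′≰M)

  sumBelow-base : SumBelow 0
  sumBelow-base zero b _ = sumBelow-zeroˡ 0 b
  sumBelow-base (suc a) zero _ = sumBelow-zeroʳ 0 (suc a)
  sumBelow-base (suc a) (suc b) a+b≤1 = ⊥-elim (<⇒≱ (s≤s (s≤s z≤n)) (subst (_≤ 1) (+-suc (suc a) b) a+b≤1))

  sumAbove-base : SumAbove 0
  sumAbove-base a b zero _ _ a+b≡1 = sumAbove-exact 0 sumBelow-base a b a+b≡1
  sumAbove-base (suc zero) (suc zero) (suc zero) _ _ refl rewrite thetaLex-full 0 | q-full 0 | ⊓-idem m = ≤-refl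
  sumAbove-base zero (suc (suc _)) (suc _) _ (s≤s ()) _
  sumAbove-base (suc zero) zero (suc _) _ _ ()
  sumAbove-base (suc zero) (suc zero) (suc (suc _)) _ _ ()
  sumAbove-base (suc zero) (suc (suc _)) (suc _) _ (s≤s ()) _
  sumAbove-base (suc (suc _)) _ (suc _) (s≤s ()) _ _

  sumBelow-suc : 1 ≤ m → ∀ n → SumBelow n → SumAbove n → SumBelow (suc n)
  sumBelow-suc 1≤m n below above zero b _ = sumBelow-zeroˡ (suc n) b
  sumBelow-suc 1≤m n below above (suc a) zero _ = sumBelow-zeroʳ (suc n) (suc a)
  sumBelow-suc 1≤m n below above (suc a) (suc b) =
    sumBelow-suc-pos 1≤m n below above (suc a) (suc b) (s≤s z≤n) (s≤s z≤n)

  sumAbove-suc : 1 ≤ m → ∀ n → SumBelow n → SumAbove n → SumBelow (suc n) → SumAbove (suc n)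
  sumAbove-suc 1≤m n below above below′ a b zero _ _ a+b≡ = sumAbove-exact (suc n) below′ a b a+b≡
  sumAbove-suc 1≤m n below above below′ zero b (suc c) _ b≤mM b≡ =
    ⊥-elim (<⇒≱ (subst (m * m ^ n <_) (sym b≡) (m<m+n (m * m ^ n) (s≤s z≤n))) b≤mM)
  sumAbove-suc 1≤m n below above below′ (suc a) zero (suc c) a≤mM _ a≡ =
    ⊥-elim (<⇒≱ (subst (m * m ^ n <_) (trans (sym a≡) (+-identityʳ (suc a))) (m<m+n (m * m ^ n) (s≤s z≤n))) a≤mM)
  sumAbove-suc 1≤m n below above below′ (suc a) (suc b) (suc c) =
    sumAbove-suc-pos 1≤m n below above (suc a) (suc b) (suc c) (s≤s z≤n) (s≤s z≤n) (s≤s z≤n)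

  sumBelow×sumAbove : 1 ≤ m → ∀ n → SumBelow n × SumAbove n
  sumBelow×sumAbove 1≤m zero = sumBelow-base , sumAbove-base
  sumBelow×sumAbove 1≤m (suc n) with sumBelow×sumAbove 1≤m n
  ... | below , above = below′ , sumAbove-suc 1≤m n below above below′
    where
    below′ : SumBelow (suc n)
    below′ = sumBelow-suc 1≤m n below above

  thetaLex-below : 1 ≤ m → ∀ n a b → b ≤ a → a + b ≤ m ^ n →
    thetaLex n m (a + b) + (q n m b + q n m (a + b)) ≤ thetaLex n m a + thetaLex n m b + q n m a
  thetaLex-below 1≤m n a b b≤a a+b≤M = +-cancelʳ-≤ (q n m b) _ _ (begin
    θ (a + b) + (Q b + Q (a + b)) + Q b  ≡⟨ regroup (θ (a + b)) (Q b) (Q (a + b)) ⟩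
    Φ n (a + b) + 2 * Q b                ≡⟨ cong (λ w → Φ n (a + b) + 2 * w) (sym (m≥n⇒m⊓n≡n (q-mono m n b≤a))) ⟩
    Φ n (a + b) + 2 * (Q a ⊓ Q b)        ≤⟨ proj₁ (sumBelow×sumAbove 1≤m n) a b a+b≤M ⟩
    Φ n a + Φ n b                        ≡⟨ regroup′ (θ a) (Q a) (θ b) (Q b) ⟩
    θ a + θ b + Q a + Q b                ∎)
    where
    open ≤-Reasoning
    θ = thetaLex n m
    Q = q n m
    regroup : ∀ t b ab → t + (b + ab) + b ≡ t + ab + 2 * b
    regroup = solve-∀
    regroup′ : ∀ ta qa tb qb → ta + qa + (tb + qb) ≡ ta + tb + qa + qb
    regroup′ = solve-∀

  thetaLex-above : 1 ≤ m → ∀ n a b → a ≤ m ^ n → b ≤ a → m ^ n ≤ a + b →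
    thetaLex n m (a + b ∸ m ^ n) + q n m b + m ≤ thetaLex n m a + thetaLex n m b + (q n m (a + b ∸ m ^ n) + q n m a)
  thetaLex-above 1≤m n a b a≤M b≤a M≤a+b = +-cancelʳ-≤ (Q b + Q c) _ _ (begin
    θ c + Q b + m + (Q b + Q c)    ≡⟨ regroup (θ c) (Q b) m (Q c) ⟩
    Φ n c + m + 2 * Q b            ≡⟨ cong (λ w → Φ n c + m + 2 * w) (sym (m≥n⇒m⊓n≡n (q-mono m n b≤a))) ⟩
    Φ n c + m + 2 * (Q a ⊓ Q b)    ≤⟨ proj₂ (sumBelow×sumAbove 1≤m n) a b c a≤M (≤-trans b≤a a≤M) (sym (m+[n∸m]≡n M≤a+b)) ⟩
    Φ n a + Φ n b + 2 * Q c        ≡⟨ regroup′ (θ a) (Q a) (θ b) (Q b) (Q c) ⟩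
    θ a + θ b + (Q c + Q a) + (Q b + Q c) ∎)
    where
    open ≤-Reasoning
    c = a + b ∸ m ^ n
    θ = thetaLex n m
    Q = q n m
    regroup : ∀ tc qb m qc → tc + qb + m + (qb + qc) ≡ tc + qc + m + 2 * qb
    regroup = solve-∀
    regroup′ : ∀ ta qa tb qb qc → ta + qa + (tb + qb) + 2 * qc ≡ ta + tb + (qc + qa) + (qb + qc)
    regroup′ = solve-∀

-- The theorem in terms of σ

open import Data.Integer using (+_; _-_; -_; +≤+) renaming (_+_ to _+ℤ_; _≤_ to _≤ℤ_)
import Data.Integer.Properties as ℤ
import Data.Integer.Tactic.RingSolver as ℤ

m≤n+o⇒m-o≤n : ∀ X Z U → X ≤ U + Z → + X - + Z ≤ℤ + U
m≤n+o⇒m-o≤n X Z U X≤U+Z = ℤ.≤-trans (ℤ.+-monoˡ-≤ (- + Z) (+≤+ X≤U+Z)) (ℤ.≤-reflexive (cancel (+ U) (+ Z)))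
  where
  cancel : ∀ u z → (u +ℤ z) - z ≡ u
  cancel = ℤ.solve-∀

σ<-bound : ∀ P S T U → P + S ≤ U + T → + P +ℤ (+ S - + T) ≤ℤ + U
σ<-bound P S T U P+S≤U+T = ℤ.≤-trans (ℤ.≤-reflexive (regroup (+ P) (+ S) (+ T))) (m≤n+o⇒m-o≤n (P + S) T U P+S≤U+T)
  where
  regroup : ∀ p s t → p +ℤ (s - t) ≡ (p +ℤ s) - t
  regroup = ℤ.solve-∀

σ≥-bound : ∀ P S T W V U → P + S + W ≤ U + (T + V) → + P +ℤ (((+ S - + T) +ℤ + W) - + V) ≤ℤ + U
σ≥-bound P S T W V U P+S+W≤U+T+V =
  ℤ.≤-trans (ℤ.≤-reflexive (regroup (+ P) (+ S) (+ T) (+ W) (+ V))) (m≤n+o⇒m-o≤n (P + S + W) (T + V) U P+S+W≤U+T+V)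
  where
  regroup : ∀ p s t w v → p +ℤ (((s - t) +ℤ w) - v) ≡ ((p +ℤ s) +ℤ w) - (t +ℤ v)
  regroup = ℤ.solve-∀

mainTheorem3 : (n m ℓa ℓb : ℕ) → 1 ≤ n → 2 ≤ m →
    ℓa ≤ m ^ n → ℓb ≤ ℓa → 0 < ℓb →
    ((ℓa + ℓb ≤ m ^ n →
    (+ thetaLex n m (ℓa + ℓb)) +ℤ σ n m ℓa ℓb
    ≤ℤ (+ thetaLex n m ℓa) +ℤ (+ thetaLex n m ℓb))
    × (ℓa + ℓb ≥ m ^ n →
    (+ thetaLex n m (ℓa + ℓb ∸ m ^ n)) +ℤ σ n m ℓa ℓb
    ≤ℤ (+ thetaLex n m ℓa) +ℤ (+ thetaLex n m ℓb)))
mainTheorem3 n m a b _ 2≤m a≤M b≤a _ = below , above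
  where
  1≤m : 1 ≤ m
  1≤m = ≤-trans (s≤s z≤n) 2≤m
  θ = thetaLex n m
  Q = q n m
  c = a + b ∸ m ^ n
  σ≥ = ((+ Q b - + Q c) +ℤ + m) - + Q a
  above′ : a + b ≥ m ^ n → + θ c +ℤ σ≥ ≤ℤ + θ a +ℤ + θ b
  above′ M≤a+b = σ≥-bound (θ c) (Q b) (Q c) m (Q a) (θ a + θ b) (thetaLex-above m 1≤m n a b a≤M b≤a M≤a+b)
  above : a + b ≥ m ^ n → + θ c +ℤ σ n m a b ≤ℤ + θ a +ℤ + θ b
  above M≤a+b with a + b <ᵇ m ^ n in a+b<ᵇM
  ... | true = ⊥-elim (<⇒≱ (<ᵇ≡true⇒< (a + b) (m ^ n) a+b<ᵇM) M≤a+b)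
  ... | false = above′ M≤a+b
  below : a + b ≤ m ^ n → + θ (a + b) +ℤ σ n m a b ≤ℤ + θ a +ℤ + θ b
  below a+b≤M with a + b <ᵇ m ^ n in a+b<ᵇM
  ... | true = σ<-bound (θ (a + b)) (Q b + Q (a + b)) (Q a) (θ a + θ b) (thetaLex-below m 1≤m n a b b≤a a+b≤M)
  ... | false = subst (λ t → + t +ℤ σ≥ ≤ℤ + θ a +ℤ + θ b) θc≡θ[a+b] (above′ M≤a+b)
    where
    M≤a+b : m ^ n ≤ a + b
    M≤a+b = <ᵇ≡false⇒≥ (a + b) (m ^ n) a+b<ᵇM
    a+b≡M : a + b ≡ m ^ n
    a+b≡M = ≤-antisym a+b≤M M≤a+b
    θc≡θ[a+b] : θ c ≡ θ (a + b)
    θc≡θ[a+b] = begin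
      θ c            ≡⟨ cong (λ w → θ (w ∸ m ^ n)) a+b≡M ⟩
      θ (m ^ n ∸ m ^ n) ≡⟨ cong θ (n∸n≡0 (m ^ n)) ⟩
      θ 0            ≡⟨ thetaLex-zero m n ⟩
      0              ≡⟨ sym (thetaLex-full m n) ⟩
      θ (m ^ n)      ≡⟨ cong θ (sym a+b≡M) ⟩
      θ (a + b)      ∎
      where open ≡-Reasoning
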